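{- In the !FMC over a signature with no computation constants and whose only value constants have base type, for all closed typed computations $\vdash_c M:[\sigma\Rightarrow\tau]$ and $\vdash_c N:[\sigma\Rightarrow\tau]$, if $M=N$ in the equational theory then $M\sim N:[\sigma\Rightarrow\tau]$ (machine equivalence).
   Context: Locations $A$ with main location $\lambda$. Value types $t::=\alpha\mid[\sigma\Rightarrow\tau]$ over base types; stack types are finite sequences of value types (bottom to top); memory types $\sigma=(\sigma_a)_{a\in A}$ (finitely many nonempty), $\sigma\tau$ pointwise concatenation, $a(r)$ the memory type with $r$ at $a$ and empty elsewhere. Terms: computations $M::=*\mid [V]a.M\mid a\langle x\rangle.M\mid ?V.M$, values $V::=x\mid v\mid !M$ ($v$ value constants of base type). Sequencing: $*;M=M$, $([V]a.N);M=[V]a.(N;M)$, $(a\langle x\rangle.N);M=a\langle x\rangle.(N;M)$ (avoiding capture), $(?V.N);M=?V.(N;M)$. Typing: $*:[\tau\Rightarrow\tau]$; $V:r$, $M:[\sigma\,a(r)\Rightarrow\tau]$ give $[V]a.M:[\sigma\Rightarrow\tau]$; $x:r,\Gamma\vdash M:[\sigma\Rightarrow\tau]$ gives $a\langle x\rangle.M:[\sigma\,a(r)\Rightarrow\tau]$; $M:[\sigma\Rightarrow\tau]$ gives $!M:[\sigma\Rightarrow\tau]$; $V:[\rho\Rightarrow\sigma]$, $M:[\tau\sigma\Rightarrow\upsilon]$ give $?V.M:[\tau\rho\Rightarrow\upsilon]$; variables and constants have their declared types. For a family $x_A$ of variable sequences, $\langle x_A\rangle.M$ pops them all (top first at each location),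 $[x_A].M$ pushes them (bottom first). Equational theory $=$: least equivalence closed under term contexts containing $\langle x_A\rangle.[x_A]=*$; $[V]a.a\langle f\rangle.?f=?V$; $?(!M)=M$; $!(?V)=V$; $S;\langle x_A\rangle.[!([x_A].N)]a=[!(S;N)]a$; $S;\langle x_A\rangle.[x_A].[x_A]=S;S$; $S;\langle x_A\rangle=*$; $S;\langle x_A\rangle.(P;[x_A])=P;S$; $[V]a.a\langle y\rangle.[y]b=[V]b$ ($a\ne b$); $[V]b.a\langle x\rangle.M=a\langle x\rangle.[V]b.M$ ($a\ne b$, $x\notin\mathrm{fv}(V)$); $S:[\varepsilon_A\Rightarrow\sigma]$, $x_A:\sigma$ not free in $N,P$. Machine: a memory is a family of stacks of closed values; a state is $(S_A,M)$; transitions: $(S_A,[V]a.M)\to(S_A\text{ with }V\text{ pushed on }S_a, M)$; $(S_A\text{ with }V\text{ on top of }S_a, a\langle x\rangle.M)\to(S_A\text{ with it popped},\{V/x\}M)$; $(S_A,?(!N).M)\to(S_A,N;M)$. For closed $M:[\sigma\Rightarrow\tau]$ and a memory $S_A$ of type $\sigma$, the run from $(S_A,M)$ reaches a state $(T_A,*)$; write $(S_A,M)\Downarrow=T_A$. Machine equivalence (by induction on types): closed $M\sim M':[\sigma\Rightarrow\tau]$ iff for all memories $S_A\sim S'_A:\sigma$, $(S_A,M)\Downarrow\sim(S'_A,M')\Downarrow:\tau$; closed values $V\sim V':[\sigma\Rightarrow\tau]$ iff $?V\sim ?V':[\sigma\Rightarrow\tau]$; at base type, $v\sim v'$ iff they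 are the same constant; memories are equivalent iff their values are pairwise equivalent; for open terms with free variables $\vec u:\vec t$, equivalence means equivalence after substituting any pairwise-equivalent closed values. -}

module Defs where

open import Data.Nat using (ℕ; zero; suc; _+_; _∸_)
open import Data.Fin using (Fin; zero; suc)
open import Data.List using (List; []; _∷_)
open import Data.Vec using (Vec; []; _∷_; replicate; zipWith; lookup; _[_]%=_; _[_]≔_; allFin; toList; map)
import Data.Vec as Vec
open import Data.Product using (Σ; _×_; _,_)
open import Data.Unit using (⊤)
open import Data.Empty using (⊥)
open import Relation.Binary.PropositionalEquality using (_≡_; _≢_)

-- Stacks: finite sequences written bottom to top (snoc lists), as in the paper.

data Stack (X : Set) : Set where
  ε   : Stack X
  _▸_ : Stack X → X → Stack X

infixl 5 _▸_

_⧺_ : {X : Set} → Stack X → Stack X → Stack X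
s ⧺ ε       = s
s ⧺ (t ▸ x) = (s ⧺ t) ▸ x

slength : {X : Set} → Stack X → ℕ
slength ε       = 0
slength (s ▸ _) = suc (slength s)

-- A setting: locations A = Fin (suc nLoc) (main location λ = zero),
-- base types, and value constants, each of base type.
-- There are no computation constants.

record Setting : Set₁ where
  field
    nLoc    : ℕ
    Base    : Set
    Const   : Set
    constTy : Const → Base

module FMC (𝒮 : Setting) where
  open Setting 𝒮

  Loc : Set
  Loc = Fin (suc nLoc)

  mainLoc : Loc
  mainLoc = zero

  data Ty : Set where
    base  : Base → Ty
    [_⇒_] : Vec (Stack Ty) (suc nLoc) → Vec (Stack Ty) (suc nLoc) → Ty

  MemTy : Set
  MemTy = Vec (Stack Ty) (suc nLoc)

  εA : MemTy
  εA = replicate _ ε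

  _⊗_ : MemTy → MemTy → MemTy
  σ ⊗ τ = zipWith _⧺_ σ τ

  at : Loc → Ty → MemTy
  at a r = εA [ a ]≔ (ε ▸ r)

  -- Raw terms, variables as de Bruijn indices

  data Tm : Set
  data Val : Set

  data Tm where
    ⋆    : Tm
    push : Val → Loc → Tm → Tm
    pop  : Loc → Tm → Tm         -- a⟨x⟩.M   (binds index 0 in M)
    app  : Val → Tm → Tm

  data Val where
    var  : ℕ → Val
    con  : Const → Val
    bang : Tm → Val

  ext : (ℕ → ℕ) → ℕ → ℕ
  ext ρ zero    = zero
  ext ρ (suc i) = suc (ρ i)

  ren  : (ℕ → ℕ) → Tm → Tm
  renV : (ℕ → ℕ) → Val → Val
  ren ρ ⋆            = ⋆
  ren ρ (push V a M) = push (renV ρ V) a (ren ρ M)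
  ren ρ (pop a M)    = pop a (ren (ext ρ) M)
  ren ρ (app V M)    = app (renV ρ V) (ren ρ M)
  renV ρ (var i)  = var (ρ i)
  renV ρ (con c)  = con c
  renV ρ (bang M) = bang (ren ρ M)

  wk : Tm → Tm
  wk = ren suc

  wkV : Val → Val
  wkV = renV suc

  wkN : ℕ → Tm → Tm
  wkN k = ren (k +_)

  exts : (ℕ → Val) → ℕ → Val
  exts s zero    = var zero
  exts s (suc i) = wkV (s i)

  sub  : (ℕ → Val) → Tm → Tm
  subV : (ℕ → Val) → Val → Val
  sub s ⋆            = ⋆
  sub s (push V a M) = push (subV s V) a (sub s M)
  sub s (pop a M)    = pop a (sub (exts s) M)
  sub s (app V M)    = app (subV s V) (sub s M)
  subV s (var i)  = s i
  subV s (con c)  = con c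
  subV s (bang M) = bang (sub s M)

  sub0 : Val → Tm → Tm
  sub0 V = sub (λ { zero → V ; (suc i) → var i })

  _⨾_ : Tm → Tm → Tm
  ⋆ ⨾ M          = M
  push V a N ⨾ M = push V a (N ⨾ M)
  pop a N ⨾ M    = pop a (N ⨾ wk M)
  app V N ⨾ M    = app V (N ⨾ M)

  infixr 4 _⨾_

  ¿_ : Val → Tm
  ¿ V = app V ⋆

  -- Families of variables x_A : σ.
  -- ⟨x_A⟩.M pops, location by location (in the order of Fin), all of σ
  -- (top first at each location); under these binders, [x_A].M pushes
  -- the bound variables back (bottom first at each location).

  shape : MemTy → List (Loc × ℕ)
  shape σ = toList (zipWith _,_ (allFin _) (map slength σ))

  size : MemTy → ℕ
  size σ = Vec.sum (map slength σ)

  popShape : List (Loc × ℕ) → Tm → Tm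
  popShape []                  M = M
  popShape ((a , zero) ∷ ls)   M = popShape ls M
  popShape ((a , suc n) ∷ ls)  M = pop a (popShape ((a , n) ∷ ls) M)

  -- the k-th popped variable (k counted from 0) has index tot ∸ suc k
  pushLoc : Loc → ℕ → ℕ → ℕ → Tm → Tm
  pushLoc a tot o zero    K = K
  pushLoc a tot o (suc j) K = push (var (tot ∸ suc (o + j))) a (pushLoc a tot o j K)

  pushShape : ℕ → ℕ → List (Loc × ℕ) → Tm → Tm
  pushShape tot o []             M = M
  pushShape tot o ((a , n) ∷ ls) M = pushLoc a tot o n (pushShape tot (o + n) ls M)

  ⟨_⟩∙_ : MemTy → Tm → Tm
  ⟨ σ ⟩∙ M = popShape (shape σ) M

  -- [x_A].M  with x_A : σ (to be used directly under ⟨ σ ⟩∙)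
  [_]∙_ : MemTy → Tm → Tm
  [ σ ]∙ M = pushShape (size σ) 0 (shape σ) M

  Ctx : Set
  Ctx = List Ty

  data _∋_∶_ : Ctx → ℕ → Ty → Set where
    here  : ∀ {Γ t} → (t ∷ Γ) ∋ zero ∶ t
    there : ∀ {Γ t u i} → Γ ∋ i ∶ t → (u ∷ Γ) ∋ suc i ∶ t

  data _⊢_∶_⇒_ : Ctx → Tm → MemTy → MemTy → Set
  data _⊢v_∶_  : Ctx → Val → Ty → Set

  data _⊢_∶_⇒_ where
    t⋆    : ∀ {Γ τ} → Γ ⊢ ⋆ ∶ τ ⇒ τ
    tpush : ∀ {Γ V r a M σ τ} → Γ ⊢v V ∶ r → Γ ⊢ M ∶ (σ ⊗ at a r) ⇒ τ
          → Γ ⊢ push V a M ∶ σ ⇒ τ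
    tpop  : ∀ {Γ r a M σ τ} → (r ∷ Γ) ⊢ M ∶ σ ⇒ τ
          → Γ ⊢ pop a M ∶ (σ ⊗ at a r) ⇒ τ
    tapp  : ∀ {Γ V M ρ σ τ υ} → Γ ⊢v V ∶ [ ρ ⇒ σ ] → Γ ⊢ M ∶ (τ ⊗ σ) ⇒ υ
          → Γ ⊢ app V M ∶ (τ ⊗ ρ) ⇒ υ

  data _⊢v_∶_ where
    tvar  : ∀ {Γ i t} → Γ ∋ i ∶ t → Γ ⊢v var i ∶ t
    tcon  : ∀ {Γ c} → Γ ⊢v con c ∶ base (constTy c)
    tbang : ∀ {Γ M σ τ} → Γ ⊢ M ∶ σ ⇒ τ → Γ ⊢v bang M ∶ [ σ ⇒ τ ]

  data Ax (Γ : Ctx) : Tm → Tm → Set where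
    ax-η    : ∀ σ → Ax Γ (⟨ σ ⟩∙ [ σ ]∙ ⋆) ⋆
    ax-β    : ∀ V a → Ax Γ (push V a (pop a (¿ (var zero)))) (¿ V)
    ax-?!   : ∀ M → Ax Γ (¿ (bang M)) M
    ax-S!   : ∀ {S σ} N a → Γ ⊢ S ∶ εA ⇒ σ
            → Ax Γ (S ⨾ ⟨ σ ⟩∙ push (bang ([ σ ]∙ wkN (size σ) N)) a ⋆)
                   (push (bang (S ⨾ N)) a ⋆)
    ax-SS   : ∀ {S σ} → Γ ⊢ S ∶ εA ⇒ σ
            → Ax Γ (S ⨾ ⟨ σ ⟩∙ [ σ ]∙ [ σ ]∙ ⋆) (S ⨾ S)
    ax-S⋆   : ∀ {S σ} → Γ ⊢ S ∶ εA ⇒ σ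
            → Ax Γ (S ⨾ ⟨ σ ⟩∙ ⋆) ⋆
    ax-SP   : ∀ {S σ} P → Γ ⊢ S ∶ εA ⇒ σ
            → Ax Γ (S ⨾ ⟨ σ ⟩∙ (wkN (size σ) P ⨾ [ σ ]∙ ⋆)) (P ⨾ S)
    ax-move : ∀ V {a b} → a ≢ b
            → Ax Γ (push V a (pop a (push (var zero) b ⋆))) (push V b ⋆)
    ax-comm : ∀ V M {a b} → a ≢ b
            → Ax Γ (push V b (pop a M)) (pop a (push (wkV V) b M))

  data AxV : Val → Val → Set where
    ax-!? : ∀ V → AxV (bang (¿ V)) V

  data _⊢_≐_∶_⇒_ : Ctx → Tm → Tm → MemTy → MemTy → Set
  data _⊢v_≐_∶_  : Ctx → Val → Val → Ty → Set

  data _⊢_≐_∶_⇒_ where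
    ax     : ∀ {Γ M N σ τ} → Ax Γ M N → Γ ⊢ M ∶ σ ⇒ τ → Γ ⊢ N ∶ σ ⇒ τ
           → Γ ⊢ M ≐ N ∶ σ ⇒ τ
    ≐refl  : ∀ {Γ M σ τ} → Γ ⊢ M ∶ σ ⇒ τ → Γ ⊢ M ≐ M ∶ σ ⇒ τ
    ≐sym   : ∀ {Γ M N σ τ} → Γ ⊢ M ≐ N ∶ σ ⇒ τ → Γ ⊢ N ≐ M ∶ σ ⇒ τ
    ≐trans : ∀ {Γ M N P σ τ} → Γ ⊢ M ≐ N ∶ σ ⇒ τ → Γ ⊢ N ≐ P ∶ σ ⇒ τ
           → Γ ⊢ M ≐ P ∶ σ ⇒ τ
    ≐push  : ∀ {Γ V W r a M N σ τ} → Γ ⊢v V ≐ W ∶ r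
           → Γ ⊢ M ≐ N ∶ (σ ⊗ at a r) ⇒ τ
           → Γ ⊢ push V a M ≐ push W a N ∶ σ ⇒ τ
    ≐pop   : ∀ {Γ r a M N σ τ} → (r ∷ Γ) ⊢ M ≐ N ∶ σ ⇒ τ
           → Γ ⊢ pop a M ≐ pop a N ∶ (σ ⊗ at a r) ⇒ τ
    ≐app   : ∀ {Γ V W M N ρ σ τ υ} → Γ ⊢v V ≐ W ∶ [ ρ ⇒ σ ]
           → Γ ⊢ M ≐ N ∶ (τ ⊗ σ) ⇒ υ
           → Γ ⊢ app V M ≐ app W N ∶ (τ ⊗ ρ) ⇒ υ

  data _⊢v_≐_∶_ where
    axv     : ∀ {Γ V W t} → AxV V W → Γ ⊢v V ∶ t → Γ ⊢v W ∶ t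
            → Γ ⊢v V ≐ W ∶ t
    ≐vrefl  : ∀ {Γ V t} → Γ ⊢v V ∶ t → Γ ⊢v V ≐ V ∶ t
    ≐vsym   : ∀ {Γ V W t} → Γ ⊢v V ≐ W ∶ t → Γ ⊢v W ≐ V ∶ t
    ≐vtrans : ∀ {Γ U V W t} → Γ ⊢v U ≐ V ∶ t → Γ ⊢v V ≐ W ∶ t
            → Γ ⊢v U ≐ W ∶ t
    ≐bang   : ∀ {Γ M N σ τ} → Γ ⊢ M ≐ N ∶ σ ⇒ τ
            → Γ ⊢v bang M ≐ bang N ∶ [ σ ⇒ τ ]

  Memory : Set
  Memory = Vec (Stack Val) (suc nLoc)

  pushM : Memory → Loc → Val → Memory
  pushM S a V = S [ a ]%= (_▸ V)

  data ⟨_,_⟩⇓_ : Memory → Tm → Memory → Set where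
    halt  : ∀ {S} → ⟨ S , ⋆ ⟩⇓ S
    mpush : ∀ {S V a M T} → ⟨ pushM S a V , M ⟩⇓ T → ⟨ S , push V a M ⟩⇓ T
    mpop  : ∀ {S a s V M T} → lookup S a ≡ (s ▸ V)
          → ⟨ S [ a ]≔ s , sub0 V M ⟩⇓ T → ⟨ S , pop a M ⟩⇓ T
    mapp  : ∀ {S N M T} → ⟨ S , N ⨾ M ⟩⇓ T → ⟨ S , app (bang N) M ⟩⇓ T

  data StackTy : Stack Val → Stack Ty → Set where
    sε : StackTy ε ε
    s▸ : ∀ {s r V t} → StackTy s r → [] ⊢v V ∶ t → StackTy (s ▸ V) (r ▸ t)

  MemOf : Memory → MemTy → Set
  MemOf S σ = ∀ a → StackTy (lookup S a) (lookup σ a)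

  ValRel   : Ty → Val → Val → Set
  TmRel    : MemTy → MemTy → Tm → Tm → Set
  MemRel   : ∀ {m} → Vec (Stack Ty) m → Vec (Stack Val) m → Vec (Stack Val) m → Set
  StackRel : Stack Ty → Stack Val → Stack Val → Set

  ValRel (base b)    V V' = Σ Const λ c → constTy c ≡ b × V ≡ con c × V' ≡ con c
  ValRel [ σ ⇒ τ ]  V V' = TmRel σ τ (¿ V) (¿ V')

  TmRel σ τ M M' =
    ∀ S S' → MemOf S σ → MemOf S' σ → MemRel σ S S' →
    Σ Memory λ T → Σ Memory λ T' →
      ⟨ S , M ⟩⇓ T × ⟨ S' , M' ⟩⇓ T' × MemRel τ T T'

  MemRel []      []      []        = ⊤
  MemRel (s ∷ σ) (x ∷ S) (y ∷ S')  = StackRel s x y × MemRel σ S S'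

  StackRel ε       ε       ε        = ⊤
  StackRel (s ▸ t) (x ▸ V) (y ▸ V') = StackRel s x y × ValRel t V V'
  StackRel _       _       _        = ⊥

-- A logical-relations argument. Machine equivalence is extended to open terms by closing them with
-- pairwise related substitutions; compatibility with every term former gives the fundamental lemma
-- (each typed term is related to itself, so in particular every closed computation terminates), and
-- determinism of the machine makes the relation transitive. The axioms are then validated run by run:
-- a computation S : [ε ⇒ σ] pushes the same family of stacks H onto every memory, ⟨x_A⟩ pops exactly
-- H and binds it to x_A, and [x_A] pushes H back, so each run of a left-hand side rearranges into a
-- run of the right-hand side ending in the same memory. The exception is S;⟨x_A⟩.[!([x_A].N)]a =
-- [!(S;N)]a, whose two sides push different thunks; they are related because forcing either runs S;N.
module Submission where

open import Defs
open import Data.Nat using (ℕ; zero; suc; _+_; _∸_)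
open import Data.Nat.Properties using (+-suc; +-identityʳ; m+n∸m≡n; suc-injective)
open import Data.Fin using (Fin; zero; suc)
open import Data.List using (List; []; _∷_)
import Data.List as List
open import Data.Vec using (Vec; []; _∷_; replicate; zipWith; lookup; updateAt; _[_]%=_; _[_]≔_; tabulate; toList)
import Data.Vec as Vec
open import Data.Vec.Properties
  using (zipWith-assoc; zipWith-identityʳ; lookup-zipWith;
         lookup∘updateAt; lookup∘updateAt′; updateAt-commutes; updateAt-updateAt; updateAt-id-local)
open import Data.Vec.Relation.Binary.Pointwise.Inductive as Pointwise using (Pointwise; []; _∷_)
import Data.Vec.Relation.Binary.Pointwise.Extensional as Extensional
open import Data.Product using (∃; _×_; _,_; proj₁; proj₂; map; map₁; zip′; swap)
open import Data.Unit using (⊤; tt)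
open import Function using (_∘_; id; const)
open import Relation.Binary.PropositionalEquality
open import Data.List.Properties using (map-∘; map-id)

module _ {X : Set} where

  ⧺-assoc : (s t u : Stack X) → (s ⧺ t) ⧺ u ≡ s ⧺ (t ⧺ u)
  ⧺-assoc s t ε       = refl
  ⧺-assoc s t (u ▸ x) = cong (_▸ x) (⧺-assoc s t u)

  ⧺-identityˡ : (s : Stack X) → ε ⧺ s ≡ s
  ⧺-identityˡ ε       = refl
  ⧺-identityˡ (s ▸ x) = cong (_▸ x) (⧺-identityˡ s)

  slength-⧺ : (s t : Stack X) → slength (s ⧺ t) ≡ slength s + slength t
  slength-⧺ s ε       = sym (+-identityʳ _)
  slength-⧺ s (t ▸ _) = trans (cong suc (slength-⧺ s t)) (sym (+-suc _ _))

  ▸-injective : ∀ {s s' : Stack X} {x x'} → s ▸ x ≡ s' ▸ x' → s ≡ s' × x ≡ x'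
  ▸-injective refl = refl , refl

  ⧺-injective : ∀ {s s'} (t t' : Stack X) → slength t ≡ slength t' →
    s ⧺ t ≡ s' ⧺ t' → s ≡ s' × t ≡ t'
  ⧺-injective ε        ε          _ eq    = eq , refl
  ⧺-injective (t ▸ x) (t' ▸ x') len eq with ▸-injective eq
  ... | eq' , refl with ⧺-injective t t' (suc-injective len) eq'
  ... | refl , refl = refl , refl

  -- On memory types, _⊕_ is the paper's juxtaposition σ τ (FMC._⊗_) and single a r is a(r).
  _⊕_ : ∀ {k} → Vec (Stack X) k → Vec (Stack X) k → Vec (Stack X) k
  F ⊕ G = zipWith _⧺_ F G

  single : ∀ {k} → Fin k → X → Vec (Stack X) k
  single a x = replicate _ ε [ a ]≔ (ε ▸ x)

  ⊕-assoc : ∀ {k} (F G H : Vec (Stack X) k) → (F ⊕ G) ⊕ H ≡ F ⊕ (G ⊕ H)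
  ⊕-assoc = zipWith-assoc ⧺-assoc

  ⊕-identityʳ : ∀ {k} (F : Vec (Stack X) k) → F ⊕ replicate k ε ≡ F
  ⊕-identityʳ = zipWith-identityʳ (λ _ → refl)

  updateAt-⊕ : ∀ {k} (F G : Vec (Stack X) k) a {f g : Stack X → Stack X} →
    (∀ s → f (lookup F a ⧺ s) ≡ lookup F a ⧺ g s) → updateAt (F ⊕ G) a f ≡ F ⊕ updateAt G a g
  updateAt-⊕ (u ∷ F) (v ∷ G) zero    fg = cong (_∷ _) (fg v)
  updateAt-⊕ (u ∷ F) (v ∷ G) (suc a) fg = cong (_ ∷_) (updateAt-⊕ F G a fg)

  updateAt-restore : ∀ {k} (F : Vec (Stack X) k) a (f : Stack X → Stack X) →
    (F [ a ]%= f) [ a ]≔ lookup F a ≡ F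
  updateAt-restore F a f = trans (updateAt-updateAt a F) (updateAt-id-local a F refl)

SameShape : ∀ {X Y : Set} {k} → Vec (Stack X) k → Vec (Stack Y) k → Set
SameShape = Pointwise (λ s t → slength s ≡ slength t)

⊕-injectiveʳ : ∀ {X Y : Set} {k} {F F' H H' : Vec (Stack X) k} (σ : Vec (Stack Y) k) →
  SameShape H σ → SameShape H' σ → F ⊕ H ≡ F' ⊕ H' → F ≡ F' × H ≡ H'
⊕-injectiveʳ {F = []} {[]} {[]} {[]} [] [] [] refl = refl , refl
⊕-injectiveʳ {F = _ ∷ _} {_ ∷ _} {h ∷ _} {h' ∷ _} (_ ∷ σ) (l ∷ ls) (l' ∷ ls') eq
  with ⧺-injective h h' (trans l (sym l')) (cong Vec.head eq) | ⊕-injectiveʳ σ ls ls' (cong Vec.tail eq)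
... | refl , refl | refl , refl = refl , refl

-- Popping and pushing a family of stacks

module _ {X : Set} where

  reverse : Stack X → Stack X
  reverse ε       = ε
  reverse (s ▸ x) = (ε ▸ x) ⧺ reverse s

  slength-reverse : (s : Stack X) → slength (reverse s) ≡ slength s
  slength-reverse ε       = refl
  slength-reverse (s ▸ x) = trans (slength-⧺ (ε ▸ x) (reverse s)) (cong suc (slength-reverse s))

  _∷ₛ_ : X → (ℕ → X) → ℕ → X
  (x ∷ₛ θ) zero    = x
  (x ∷ₛ θ) (suc i) = θ i

  -- s ++ₛ θ binds the elements of s to the first indices, the top of s to index 0.
  _++ₛ_ : Stack X → (ℕ → X) → ℕ → X
  ε       ++ₛ θ = θ
  (s ▸ x) ++ₛ θ = x ∷ₛ (s ++ₛ θ)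

  ++ₛ-⧺ : ∀ s t θ i → ((s ⧺ t) ++ₛ θ) (slength t + i) ≡ (s ++ₛ θ) i
  ++ₛ-⧺ s ε       θ i = refl
  ++ₛ-⧺ s (t ▸ _) θ i = ++ₛ-⧺ s t θ i

  ++ₛ-beyond : ∀ s θ i → (s ++ₛ θ) (slength s + i) ≡ θ i
  ++ₛ-beyond ε       θ i = refl
  ++ₛ-beyond (s ▸ _) θ i = ++ₛ-beyond s θ i

  -- The values of a family of stacks in the order ⟨x_A⟩ pops them, the last one on top.
  popOrder : ∀ {k} → Vec (Stack X) k → Stack X
  popOrder []      = ε
  popOrder (h ∷ H) = reverse h ⧺ popOrder H

  slength-popOrder : ∀ {Y : Set} {k} {H : Vec (Stack X) k} {σ : Vec (Stack Y) k} →
    SameShape H σ → slength (popOrder H) ≡ Vec.sum (Vec.map slength σ)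
  slength-popOrder {H = []}    []       = refl
  slength-popOrder {H = h ∷ H} (l ∷ ls) =
    trans (slength-⧺ (reverse h) (popOrder H)) (cong₂ _+_ (trans (slength-reverse h) l) (slength-popOrder ls))

  data Pops {k} : List (Fin k × ℕ) → Vec (Stack X) k → Stack X → Vec (Stack X) k → Stack X → Set where
    done : ∀ {F P} → Pops [] F P F P
    next : ∀ {a ls F P G Q} → Pops ls F P G Q → Pops ((a , zero) ∷ ls) F P G Q
    pop1 : ∀ {a n ls F P G Q s x} → lookup F a ≡ s ▸ x →
           Pops ((a , n) ∷ ls) (F [ a ]≔ s) (P ▸ x) G Q → Pops ((a , suc n) ∷ ls) F P G Q

shapeOf : ∀ {Y : Set} {k} → Vec (Stack Y) k → List (Fin k × ℕ)
shapeOf []      = []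
shapeOf (s ∷ σ) = (zero , slength s) ∷ List.map (map₁ suc) (shapeOf σ)

shape-tabulate : ∀ {Y : Set} {k j} (f : Fin k → Fin j) (σ : Vec (Stack Y) k) →
  toList (zipWith _,_ (tabulate f) (Vec.map slength σ)) ≡ List.map (map₁ f) (shapeOf σ)
shape-tabulate f []      = refl
shape-tabulate f (s ∷ σ) = cong (_ ∷_) (trans (shape-tabulate (f ∘ suc) σ) (map-∘ (shapeOf σ)))

module _ {X : Set} where

  Pops-head : ∀ {k} n ls {x : Stack X} {F : Vec (Stack X) k} {P G Q} →
    Pops ((zero , n) ∷ ls) (x ∷ F) P G Q →
    ∃ λ x' → ∃ λ h → x ≡ x' ⧺ h × slength h ≡ n × Pops ls (x' ∷ F) (P ⧺ reverse h) G Q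
  Pops-head zero    ls (next pops)              = _ , ε , refl , refl , pops
  Pops-head (suc n) ls {F = F} {P} {G} {Q} (pop1 {x = v} refl pops) with Pops-head n ls pops
  ... | x' , h , refl , refl , pops' =
    x' , h ▸ v , refl , refl , subst (λ R → Pops ls (x' ∷ F) R G Q) (⧺-assoc P (ε ▸ v) (reverse h)) pops'

  Pops-shift : ∀ {k} ls {x : Stack X} {F : Vec (Stack X) k} {P G Q} →
    Pops (List.map (map₁ suc) ls) (x ∷ F) P G Q →
    ∃ λ G' → G ≡ x ∷ G' × Pops ls F P G' Q
  Pops-shift []                done       = _ , refl , done
  Pops-shift ((a , zero) ∷ ls)  (next pops) with Pops-shift ls pops
  ... | G' , refl , pops' = G' , refl , next pops'
  Pops-shift ((a , suc n) ∷ ls) (pop1 top pops) with Pops-shift ((a , n) ∷ ls) pops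
  ... | G' , refl , pops' = G' , refl , pop1 top pops'

  Pops-shapeOf : ∀ {Y : Set} {k} (σ : Vec (Stack Y) k) {F : Vec (Stack X) k} {P G Q} →
    Pops (shapeOf σ) F P G Q →
    ∃ λ H → SameShape H σ × F ≡ G ⊕ H × Q ≡ P ⧺ popOrder H
  Pops-shapeOf []      {[]}    done = [] , [] , refl , refl
  Pops-shapeOf (s ∷ σ) {_ ∷ _} {P} pops with Pops-head (slength s) _ pops
  ... | _ , h , refl , lh , pops₁ with Pops-shift (shapeOf σ) pops₁
  ... | _ , refl , pops₂ with Pops-shapeOf σ pops₂
  ... | H , lH , refl , refl = h ∷ H , lh ∷ lH , refl , ⧺-assoc P (reverse h) (popOrder H)

  pushesAt : ∀ {k} → (ℕ → X) → Fin k → ℕ → ℕ → Vec (Stack X) k → Vec (Stack X) k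
  pushesAt val a o zero    W = W
  pushesAt val a o (suc j) W = pushesAt val a o j (W [ a ]%= (_▸ val (o + j)))

  pushes : ∀ {k} → (ℕ → X) → ℕ → List (Fin k × ℕ) → Vec (Stack X) k → Vec (Stack X) k
  pushes val o []             W = W
  pushes val o ((a , n) ∷ ls) W = pushes val (o + n) ls (pushesAt val a o n W)

  pushesAt-shift : ∀ {k} val (a : Fin k) o n {w} {W : Vec (Stack X) k} →
    pushesAt val (suc a) o n (w ∷ W) ≡ w ∷ pushesAt val a o n W
  pushesAt-shift val a o zero    = refl
  pushesAt-shift val a o (suc n) = pushesAt-shift val a o n

  pushes-shift : ∀ {k} val o (ls : List (Fin k × ℕ)) {w} {W : Vec (Stack X) k} →
    pushes val o (List.map (map₁ suc) ls) (w ∷ W) ≡ w ∷ pushes val o ls W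
  pushes-shift val o []             = refl
  pushes-shift val o ((a , n) ∷ ls) =
    trans (cong (pushes val (o + n) (List.map (map₁ suc) ls)) (pushesAt-shift val a o n))
          (pushes-shift val (o + n) ls)

  pushesAt-suc : ∀ {k} val (a : Fin k) o n W →
    pushesAt val a o (suc n) W ≡ pushesAt val a (suc o) n W [ a ]%= (_▸ val o)
  pushesAt-suc val a o zero    W = cong (λ i → W [ a ]%= (_▸ val i)) (+-identityʳ o)
  pushesAt-suc val a o (suc m) W =
    trans (pushesAt-suc val a o m (W [ a ]%= (_▸ val (o + suc m))))
          (cong (λ i → pushesAt val a (suc o) m (W [ a ]%= (_▸ val i)) [ a ]%= (_▸ val o)) (+-suc o m))

  TopDown : (ℕ → X) → ℕ → Stack X → Set
  TopDown val o ε       = ⊤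
  TopDown val o (h ▸ v) = val o ≡ v × TopDown val (suc o) h

  TopDownAll : ∀ {k} → (ℕ → X) → ℕ → Vec (Stack X) k → Set
  TopDownAll val o []      = ⊤
  TopDownAll val o (h ∷ H) = TopDown val o h × TopDownAll val (o + slength h) H

  pushesAt-TopDown : ∀ {k} val o h {w} {W : Vec (Stack X) k} → TopDown val o h →
    pushesAt val zero o (slength h) (w ∷ W) ≡ (w ⧺ h) ∷ W
  pushesAt-TopDown val o ε       _          = refl
  pushesAt-TopDown val o (h ▸ v) {w} {W} (refl , td) =
    trans (pushesAt-suc val zero o (slength h) (w ∷ W))
          (cong (_[ zero ]%= (_▸ val o)) (pushesAt-TopDown val (suc o) h td))

  pushes-shapeOf : ∀ {Y : Set} {k} val o (σ : Vec (Stack Y) k) {H W : Vec (Stack X) k} →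
    SameShape H σ → TopDownAll val o H → pushes val o (shapeOf σ) W ≡ W ⊕ H
  pushes-shapeOf val o []      {[]}    {[]}    _        _          = refl
  pushes-shapeOf val o (s ∷ σ) {h ∷ H} {w ∷ W} (l ∷ ls) (td , tds) rewrite sym l = begin
    pushes val (o + slength h) (List.map (map₁ suc) (shapeOf σ)) (pushesAt val zero o (slength h) (w ∷ W))
      ≡⟨ cong (pushes val (o + slength h) (List.map (map₁ suc) (shapeOf σ))) (pushesAt-TopDown val o h td) ⟩
    pushes val (o + slength h) (List.map (map₁ suc) (shapeOf σ)) ((w ⧺ h) ∷ W)
      ≡⟨ pushes-shift val (o + slength h) (shapeOf σ) ⟩
    (w ⧺ h) ∷ pushes val (o + slength h) (shapeOf σ) W
      ≡⟨ cong ((w ⧺ h) ∷_) (pushes-shapeOf val (o + slength h) σ ls tds) ⟩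
    (w ⧺ h) ∷ (W ⊕ H)
      ∎
    where open ≡-Reasoning

  -- Under Q ++ₛ θ the k-th element of Q from the bottom has index slength Q ∸ suc k (cf. pushLoc).
  fromBottom : Stack X → (ℕ → X) → ℕ → X
  fromBottom Q θ k = (Q ++ₛ θ) (slength Q ∸ suc k)

  fromBottom-⧺ : ∀ P v B θ → fromBottom ((P ▸ v) ⧺ B) θ (slength P) ≡ v
  fromBottom-⧺ P v B θ = begin
    (((P ▸ v) ⧺ B) ++ₛ θ) (slength ((P ▸ v) ⧺ B) ∸ suc (slength P))
      ≡⟨ cong (λ i → (((P ▸ v) ⧺ B) ++ₛ θ) (i ∸ suc (slength P))) (slength-⧺ (P ▸ v) B) ⟩
    (((P ▸ v) ⧺ B) ++ₛ θ) (suc (slength P) + slength B ∸ suc (slength P))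
      ≡⟨ cong (((P ▸ v) ⧺ B) ++ₛ θ)
              (trans (m+n∸m≡n (suc (slength P)) (slength B)) (sym (+-identityʳ _))) ⟩
    (((P ▸ v) ⧺ B) ++ₛ θ) (slength B + 0)
      ≡⟨ ++ₛ-⧺ (P ▸ v) B θ 0 ⟩
    v ∎
    where open ≡-Reasoning

  TopDown-fromBottom : ∀ Q θ h P R → Q ≡ (P ⧺ reverse h) ⧺ R → TopDown (fromBottom Q θ) (slength P) h
  TopDown-fromBottom Q θ ε       P R eq = tt
  TopDown-fromBottom Q θ (h ▸ v) P R eq =
    trans (cong (λ Q → fromBottom Q θ (slength P)) (trans eq' (⧺-assoc (P ▸ v) (reverse h) R)))
          (fromBottom-⧺ P v (reverse h ⧺ R) θ) ,
    TopDown-fromBottom Q θ h (P ▸ v) R eq'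
    where
    eq' : Q ≡ ((P ▸ v) ⧺ reverse h) ⧺ R
    eq' = trans eq (cong (_⧺ R) (sym (⧺-assoc P (ε ▸ v) (reverse h))))

  TopDownAll-fromBottom : ∀ {k} Q θ (H : Vec (Stack X) k) P R → Q ≡ (P ⧺ popOrder H) ⧺ R →
    TopDownAll (fromBottom Q θ) (slength P) H
  TopDownAll-fromBottom Q θ []      P R eq = tt
  TopDownAll-fromBottom Q θ (h ∷ H) P R eq =
    TopDown-fromBottom Q θ h P (popOrder H ⧺ R) (trans eq₁ (⧺-assoc (P ⧺ reverse h) (popOrder H) R)) ,
    subst (λ o → TopDownAll (fromBottom Q θ) o H)
          (trans (slength-⧺ P (reverse h)) (cong (slength P +_) (slength-reverse h)))
          (TopDownAll-fromBottom Q θ H (P ⧺ reverse h) R eq₁)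
    where
    eq₁ : Q ≡ ((P ⧺ reverse h) ⧺ popOrder H) ⧺ R
    eq₁ = trans eq (cong (_⧺ R) (sym (⧺-assoc P (reverse h) (popOrder H))))

module Soundness (𝒮 : Setting) where
  open Setting 𝒮
  open FMC 𝒮

  -- Renaming and substitution

  Subst : Set
  Subst = ℕ → Val

  ext-cong : ∀ {ρ ρ'} → ρ ≗ ρ' → ext ρ ≗ ext ρ'
  ext-cong eq zero    = refl
  ext-cong eq (suc i) = cong suc (eq i)

  ren-cong  : ∀ {ρ ρ'} → ρ ≗ ρ' → ren ρ ≗ ren ρ'
  renV-cong : ∀ {ρ ρ'} → ρ ≗ ρ' → renV ρ ≗ renV ρ'
  ren-cong eq ⋆            = refl
  ren-cong eq (push V a M) = cong₂ (λ V M → push V a M) (renV-cong eq V) (ren-cong eq M)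
  ren-cong eq (pop a M)    = cong (pop a) (ren-cong (ext-cong eq) M)
  ren-cong eq (app V M)    = cong₂ app (renV-cong eq V) (ren-cong eq M)
  renV-cong eq (var i)  = cong var (eq i)
  renV-cong eq (con c)  = refl
  renV-cong eq (bang M) = cong bang (ren-cong eq M)

  exts-cong : ∀ {θ θ'} → θ ≗ θ' → exts θ ≗ exts θ'
  exts-cong eq zero    = refl
  exts-cong eq (suc i) = cong wkV (eq i)

  sub-cong  : ∀ {θ θ'} → θ ≗ θ' → sub θ ≗ sub θ'
  subV-cong : ∀ {θ θ'} → θ ≗ θ' → subV θ ≗ subV θ'
  sub-cong eq ⋆            = refl
  sub-cong eq (push V a M) = cong₂ (λ V M → push V a M) (subV-cong eq V) (sub-cong eq M)
  sub-cong eq (pop a M)    = cong (pop a) (sub-cong (exts-cong eq) M)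
  sub-cong eq (app V M)    = cong₂ app (subV-cong eq V) (sub-cong eq M)
  subV-cong eq (var i)  = eq i
  subV-cong eq (con c)  = refl
  subV-cong eq (bang M) = cong bang (sub-cong eq M)

  ren-ren  : ∀ ρ ρ' M → ren ρ (ren ρ' M) ≡ ren (ρ ∘ ρ') M
  renV-ren : ∀ ρ ρ' V → renV ρ (renV ρ' V) ≡ renV (ρ ∘ ρ') V
  ren-ren ρ ρ' ⋆            = refl
  ren-ren ρ ρ' (push V a M) = cong₂ (λ V M → push V a M) (renV-ren ρ ρ' V) (ren-ren ρ ρ' M)
  ren-ren ρ ρ' (pop a M)    =
    cong (pop a) (trans (ren-ren (ext ρ) (ext ρ') M) (ren-cong (λ { zero → refl ; (suc i) → refl }) M))
  ren-ren ρ ρ' (app V M)    = cong₂ app (renV-ren ρ ρ' V) (ren-ren ρ ρ' M)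
  renV-ren ρ ρ' (var i)  = refl
  renV-ren ρ ρ' (con c)  = refl
  renV-ren ρ ρ' (bang M) = cong bang (ren-ren ρ ρ' M)

  sub-ren  : ∀ θ ρ M → sub θ (ren ρ M) ≡ sub (θ ∘ ρ) M
  subV-ren : ∀ θ ρ V → subV θ (renV ρ V) ≡ subV (θ ∘ ρ) V
  sub-ren θ ρ ⋆            = refl
  sub-ren θ ρ (push V a M) = cong₂ (λ V M → push V a M) (subV-ren θ ρ V) (sub-ren θ ρ M)
  sub-ren θ ρ (pop a M)    =
    cong (pop a) (trans (sub-ren (exts θ) (ext ρ) M) (sub-cong (λ { zero → refl ; (suc i) → refl }) M))
  sub-ren θ ρ (app V M)    = cong₂ app (subV-ren θ ρ V) (sub-ren θ ρ M)
  subV-ren θ ρ (var i)  = refl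
  subV-ren θ ρ (con c)  = refl
  subV-ren θ ρ (bang M) = cong bang (sub-ren θ ρ M)

  ren-sub  : ∀ ρ θ M → ren ρ (sub θ M) ≡ sub (renV ρ ∘ θ) M
  renV-sub : ∀ ρ θ V → renV ρ (subV θ V) ≡ subV (renV ρ ∘ θ) V
  ren-sub ρ θ ⋆            = refl
  ren-sub ρ θ (push V a M) = cong₂ (λ V M → push V a M) (renV-sub ρ θ V) (ren-sub ρ θ M)
  ren-sub ρ θ (pop a M)    = cong (pop a) (trans (ren-sub (ext ρ) (exts θ) M) (sub-cong ext-exts M))
    where
    ext-exts : renV (ext ρ) ∘ exts θ ≗ exts (renV ρ ∘ θ)
    ext-exts zero    = refl
    ext-exts (suc i) = trans (renV-ren (ext ρ) suc (θ i)) (sym (renV-ren suc ρ (θ i)))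
  ren-sub ρ θ (app V M)    = cong₂ app (renV-sub ρ θ V) (ren-sub ρ θ M)
  renV-sub ρ θ (var i)  = refl
  renV-sub ρ θ (con c)  = refl
  renV-sub ρ θ (bang M) = cong bang (ren-sub ρ θ M)

  sub-sub  : ∀ θ θ' M → sub θ (sub θ' M) ≡ sub (subV θ ∘ θ') M
  subV-sub : ∀ θ θ' V → subV θ (subV θ' V) ≡ subV (subV θ ∘ θ') V
  sub-sub θ θ' ⋆            = refl
  sub-sub θ θ' (push V a M) = cong₂ (λ V M → push V a M) (subV-sub θ θ' V) (sub-sub θ θ' M)
  sub-sub θ θ' (pop a M)    = cong (pop a) (trans (sub-sub (exts θ) (exts θ') M) (sub-cong exts-exts M))
    where
    exts-exts : subV (exts θ) ∘ exts θ' ≗ exts (subV θ ∘ θ')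
    exts-exts zero    = refl
    exts-exts (suc i) = trans (subV-ren (exts θ) suc (θ' i)) (sym (renV-sub suc θ (θ' i)))
  sub-sub θ θ' (app V M)    = cong₂ app (subV-sub θ θ' V) (sub-sub θ θ' M)
  subV-sub θ θ' (var i)  = refl
  subV-sub θ θ' (con c)  = refl
  subV-sub θ θ' (bang M) = cong bang (sub-sub θ θ' M)

  sub-id  : ∀ M → sub var M ≡ M
  subV-id : ∀ V → subV var V ≡ V
  sub-id ⋆            = refl
  sub-id (push V a M) = cong₂ (λ V M → push V a M) (subV-id V) (sub-id M)
  sub-id (pop a M)    = cong (pop a) (trans (sub-cong (λ { zero → refl ; (suc i) → refl }) M) (sub-id M))
  sub-id (app V M)    = cong₂ app (subV-id V) (sub-id M)
  subV-id (var i)  = refl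
  subV-id (con c)  = refl
  subV-id (bang M) = cong bang (sub-id M)

  sub0-sub : ∀ V M → sub0 V M ≡ sub (V ∷ₛ var) M
  sub0-sub V = sub-cong (λ { zero → refl ; (suc i) → refl })

  subV-wkV : ∀ θ V W → subV (V ∷ₛ θ) (wkV W) ≡ subV θ W
  subV-wkV θ V W = subV-ren (V ∷ₛ θ) suc W

  sub-wk : ∀ θ V M → sub (V ∷ₛ θ) (wk M) ≡ sub θ M
  sub-wk θ V M = sub-ren (V ∷ₛ θ) suc M

  sub0-wk : ∀ V M → sub0 V (wk M) ≡ M
  sub0-wk V M = trans (sub0-sub V (wk M)) (trans (sub-wk var V M) (sub-id M))

  sub0-exts : ∀ V θ M → sub0 V (sub (exts θ) M) ≡ sub (V ∷ₛ θ) M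
  sub0-exts V θ M = begin
    sub0 V (sub (exts θ) M)               ≡⟨ sub0-sub V _ ⟩
    sub (V ∷ₛ var) (sub (exts θ) M)       ≡⟨ sub-sub (V ∷ₛ var) (exts θ) M ⟩
    sub (subV (V ∷ₛ var) ∘ exts θ) M      ≡⟨ sub-cong (λ { zero → refl ; (suc i) → lemma i }) M ⟩
    sub (V ∷ₛ θ) M                        ∎
    where
    open ≡-Reasoning
    lemma : ∀ i → subV (V ∷ₛ var) (wkV (θ i)) ≡ θ i
    lemma i = trans (subV-wkV var V (θ i)) (subV-id (θ i))

  ren-⨾ : ∀ ρ N M → ren ρ (N ⨾ M) ≡ (ren ρ N ⨾ ren ρ M)
  ren-⨾ ρ ⋆            M = refl
  ren-⨾ ρ (push V a N) M = cong (push (renV ρ V) a) (ren-⨾ ρ N M)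
  ren-⨾ ρ (pop a N)    M = cong (pop a) (trans (ren-⨾ (ext ρ) N (wk M)) (cong (ren (ext ρ) N ⨾_) wk-comm))
    where
    wk-comm : ren (ext ρ) (wk M) ≡ wk (ren ρ M)
    wk-comm = trans (ren-ren (ext ρ) suc M) (sym (ren-ren suc ρ M))
  ren-⨾ ρ (app V N)    M = cong (app (renV ρ V)) (ren-⨾ ρ N M)

  sub-⨾ : ∀ θ N M → sub θ (N ⨾ M) ≡ (sub θ N ⨾ sub θ M)
  sub-⨾ θ ⋆            M = refl
  sub-⨾ θ (push V a N) M = cong (push (subV θ V) a) (sub-⨾ θ N M)
  sub-⨾ θ (pop a N)    M = cong (pop a) (trans (sub-⨾ (exts θ) N (wk M)) (cong (sub (exts θ) N ⨾_) wk-comm))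
    where
    wk-comm : sub (exts θ) (wk M) ≡ wk (sub θ M)
    wk-comm = trans (sub-ren (exts θ) suc M) (sym (ren-sub suc θ M))
  sub-⨾ θ (app V N)    M = cong (app (subV θ V)) (sub-⨾ θ N M)

  ⨾-assoc : ∀ K N M → ((K ⨾ N) ⨾ M) ≡ (K ⨾ (N ⨾ M))
  ⨾-assoc ⋆            N M = refl
  ⨾-assoc (push V a K) N M = cong (push V a) (⨾-assoc K N M)
  ⨾-assoc (pop a K)    N M =
    cong (pop a) (trans (⨾-assoc K (wk N) (wk M)) (cong (K ⨾_) (sym (ren-⨾ suc N M))))
  ⨾-assoc (app V K)    N M = cong (app V) (⨾-assoc K N M)

  ⨾-identityʳ : ∀ M → (M ⨾ ⋆) ≡ M
  ⨾-identityʳ ⋆            = refl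
  ⨾-identityʳ (push V a M) = cong (push V a) (⨾-identityʳ M)
  ⨾-identityʳ (pop a M)    = cong (pop a) (⨾-identityʳ M)
  ⨾-identityʳ (app V M)    = cong (app V) (⨾-identityʳ M)

  sub0-⨾ : ∀ V N M → sub0 V (N ⨾ wk M) ≡ (sub0 V N ⨾ M)
  sub0-⨾ V N M = trans (sub-⨾ _ N (wk M)) (cong (sub0 V N ⨾_) (sub0-wk V M))

  -- Typing

  _⊢ʳ_⇒_ : (ℕ → ℕ) → Ctx → Ctx → Set
  ρ ⊢ʳ Γ ⇒ Δ = ∀ {i t} → Γ ∋ i ∶ t → Δ ∋ ρ i ∶ t

  _⊢ˢ_⇒_ : Subst → Ctx → Ctx → Set
  θ ⊢ˢ Γ ⇒ Δ = ∀ {i t} → Γ ∋ i ∶ t → Δ ⊢v θ i ∶ t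

  ⊢-ren  : ∀ {ρ Γ Δ M σ τ} → ρ ⊢ʳ Γ ⇒ Δ → Γ ⊢ M ∶ σ ⇒ τ → Δ ⊢ ren ρ M ∶ σ ⇒ τ
  ⊢v-ren : ∀ {ρ Γ Δ V t} → ρ ⊢ʳ Γ ⇒ Δ → Γ ⊢v V ∶ t → Δ ⊢v renV ρ V ∶ t
  ⊢-ren ⊢ρ t⋆            = t⋆
  ⊢-ren ⊢ρ (tpush ⊢V ⊢M) = tpush (⊢v-ren ⊢ρ ⊢V) (⊢-ren ⊢ρ ⊢M)
  ⊢-ren ⊢ρ (tpop ⊢M)     = tpop (⊢-ren (λ { here → here ; (there x) → there (⊢ρ x) }) ⊢M)
  ⊢-ren ⊢ρ (tapp ⊢V ⊢M)  = tapp (⊢v-ren ⊢ρ ⊢V) (⊢-ren ⊢ρ ⊢M)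
  ⊢v-ren ⊢ρ (tvar x)   = tvar (⊢ρ x)
  ⊢v-ren ⊢ρ tcon       = tcon
  ⊢v-ren ⊢ρ (tbang ⊢M) = tbang (⊢-ren ⊢ρ ⊢M)

  ⊢-sub  : ∀ {θ Γ Δ M σ τ} → θ ⊢ˢ Γ ⇒ Δ → Γ ⊢ M ∶ σ ⇒ τ → Δ ⊢ sub θ M ∶ σ ⇒ τ
  ⊢v-sub : ∀ {θ Γ Δ V t} → θ ⊢ˢ Γ ⇒ Δ → Γ ⊢v V ∶ t → Δ ⊢v subV θ V ∶ t
  ⊢-sub ⊢θ t⋆            = t⋆
  ⊢-sub ⊢θ (tpush ⊢V ⊢M) = tpush (⊢v-sub ⊢θ ⊢V) (⊢-sub ⊢θ ⊢M)
  ⊢-sub ⊢θ (tpop ⊢M)     =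
    tpop (⊢-sub (λ { here → tvar here ; (there x) → ⊢v-ren there (⊢θ x) }) ⊢M)
  ⊢-sub ⊢θ (tapp ⊢V ⊢M)  = tapp (⊢v-sub ⊢θ ⊢V) (⊢-sub ⊢θ ⊢M)
  ⊢v-sub ⊢θ (tvar x)   = ⊢θ x
  ⊢v-sub ⊢θ tcon       = tcon
  ⊢v-sub ⊢θ (tbang ⊢M) = tbang (⊢-sub ⊢θ ⊢M)

  ⊢-sub0 : ∀ {V r M σ τ} → [] ⊢v V ∶ r → (r ∷ []) ⊢ M ∶ σ ⇒ τ → [] ⊢ sub0 V M ∶ σ ⇒ τ
  ⊢-sub0 {V} {M = M} ⊢V ⊢M =
    subst (λ K → [] ⊢ K ∶ _ ⇒ _) (sym (sub0-sub V M)) (⊢-sub (λ { here → ⊢V }) ⊢M)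

  ⊢-⨾ : ∀ {Γ N M σ ρ τ} → Γ ⊢ N ∶ σ ⇒ ρ → Γ ⊢ M ∶ ρ ⇒ τ → Γ ⊢ (N ⨾ M) ∶ σ ⇒ τ
  ⊢-⨾ t⋆            ⊢M = ⊢M
  ⊢-⨾ (tpush ⊢V ⊢N) ⊢M = tpush ⊢V (⊢-⨾ ⊢N ⊢M)
  ⊢-⨾ (tpop ⊢N)     ⊢M = tpop (⊢-⨾ ⊢N (⊢-ren there ⊢M))
  ⊢-⨾ (tapp ⊢V ⊢N)  ⊢M = tapp ⊢V (⊢-⨾ ⊢N ⊢M)

  ⊢-frame : ∀ {Γ N ρ σ} τ → Γ ⊢ N ∶ ρ ⇒ σ → Γ ⊢ N ∶ (τ ⊗ ρ) ⇒ (τ ⊗ σ)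
  ⊢-frame τ t⋆                                    = t⋆
  ⊢-frame τ (tpush {r = r} {a = a} {σ = σ} ⊢V ⊢M) =
    tpush ⊢V (subst (λ υ → _ ⊢ _ ∶ υ ⇒ _) (sym (⊕-assoc τ σ (at a r))) (⊢-frame τ ⊢M))
  ⊢-frame τ (tpop {r = r} {a = a} {σ = σ} ⊢M)     =
    subst (λ υ → _ ⊢ _ ∶ υ ⇒ _) (⊕-assoc τ σ (at a r)) (tpop (⊢-frame τ ⊢M))
  ⊢-frame τ (tapp {ρ = ρ} {σ = σ} {τ = τ'} ⊢V ⊢M) =
    subst (λ υ → _ ⊢ _ ∶ υ ⇒ _) (⊕-assoc τ τ' ρ)
      (tapp ⊢V (subst (λ υ → _ ⊢ _ ∶ υ ⇒ _) (sym (⊕-assoc τ τ' σ)) (⊢-frame τ ⊢M)))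

  -- Typed and related memories

  Typed : ∀ {k} → Vec (Stack Val) k → Vec (Stack Ty) k → Set
  Typed = Pointwise StackTy

  MemOf⇒Typed : ∀ S σ → MemOf S σ → Typed S σ
  MemOf⇒Typed S σ h = Extensional.extensional⇒inductive (Extensional.ext h)

  Typed⇒MemOf : ∀ {S σ} → Typed S σ → MemOf S σ
  Typed⇒MemOf = Pointwise.lookup

  StackTy-⧺ : ∀ {f g t r} → StackTy f t → StackTy g r → StackTy (f ⧺ g) (t ⧺ r)
  StackTy-⧺ ⊢f sε         = ⊢f
  StackTy-⧺ ⊢f (s▸ ⊢g ⊢V) = s▸ (StackTy-⧺ ⊢f ⊢g) ⊢V

  StackTy-split : ∀ {x} t r → StackTy x (t ⧺ r) →
    ∃ λ f → ∃ λ g → x ≡ f ⧺ g × StackTy f t × StackTy g r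
  StackTy-split t ε       ⊢x          = _ , ε , refl , ⊢x , sε
  StackTy-split t (r ▸ u) (s▸ ⊢x ⊢V) with StackTy-split t r ⊢x
  ... | f , g , refl , ⊢f , ⊢g = f , g ▸ _ , refl , ⊢f , s▸ ⊢g ⊢V

  StackTy-slength : ∀ {x s} → StackTy x s → slength x ≡ slength s
  StackTy-slength sε        = refl
  StackTy-slength (s▸ ⊢x _) = cong suc (StackTy-slength ⊢x)

  Typed⇒SameShape : ∀ {k} {S : Vec (Stack Val) k} {σ} → Typed S σ → SameShape S σ
  Typed⇒SameShape = Pointwise.map StackTy-slength

  Typed-ε : ∀ {k} → Typed (replicate k ε) (replicate k ε)
  Typed-ε {zero}  = []
  Typed-ε {suc k} = sε ∷ Typed-ε

  Typed-⊕ : ∀ {k} {F G : Vec (Stack Val) k} {τ ρ} → Typed F τ → Typed G ρ → Typed (F ⊕ G) (τ ⊕ ρ)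
  Typed-⊕ []         []         = []
  Typed-⊕ (⊢f ∷ ⊢F) (⊢g ∷ ⊢G) = StackTy-⧺ ⊢f ⊢g ∷ Typed-⊕ ⊢F ⊢G

  Typed-split : ∀ {k} {S : Vec (Stack Val) k} τ ρ → Typed S (τ ⊕ ρ) →
    ∃ λ F → ∃ λ G → S ≡ F ⊕ G × Typed F τ × Typed G ρ
  Typed-split []      []      []         = [] , [] , refl , [] , []
  Typed-split (t ∷ τ) (r ∷ ρ) (⊢x ∷ ⊢S) with StackTy-split t r ⊢x | Typed-split τ ρ ⊢S
  ... | f , g , refl , ⊢f , ⊢g | F , G , refl , ⊢F , ⊢G =
    f ∷ F , g ∷ G , refl , ⊢f ∷ ⊢F , ⊢g ∷ ⊢G

  Typed-push : ∀ {k} a {S : Vec (Stack Val) k} {σ V r} → Typed S σ → [] ⊢v V ∶ r →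
    Typed (S [ a ]%= (_▸ V)) (σ ⊕ single a r)
  Typed-push zero    {σ = s ∷ σ} (⊢x ∷ ⊢S) ⊢V =
    s▸ ⊢x ⊢V ∷ subst (Typed _) (sym (⊕-identityʳ σ)) ⊢S
  Typed-push (suc a) {σ = _ ∷ _} (⊢x ∷ ⊢S) ⊢V = ⊢x ∷ Typed-push a ⊢S ⊢V

  Typed-pop : ∀ {k} a {S : Vec (Stack Val) k} {σ r} → Typed S (σ ⊕ single a r) →
    ∃ λ s → ∃ λ V → lookup S a ≡ s ▸ V × [] ⊢v V ∶ r × Typed (S [ a ]≔ s) σ
  Typed-pop zero    {σ = s ∷ σ} (s▸ ⊢x ⊢V ∷ ⊢S) =
    _ , _ , refl , ⊢V , ⊢x ∷ subst (Typed _) (⊕-identityʳ σ) ⊢S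
  Typed-pop (suc a) {σ = _ ∷ _} (⊢x ∷ ⊢S) with Typed-pop a ⊢S
  ... | s , V , eq , ⊢V , ⊢S' = s , V , eq , ⊢V , ⊢x ∷ ⊢S'

  StackRel-⧺ : ∀ t r {f f' g g'} → StackRel t f f' → StackRel r g g' →
    StackRel (t ⧺ r) (f ⧺ g) (f' ⧺ g')
  StackRel-⧺ t ε       {g = ε}     {ε}      f∼f' _        = f∼f'
  StackRel-⧺ t (r ▸ u) {g = g ▸ _} {g' ▸ _} f∼f' (g∼g' , v) = StackRel-⧺ t r f∼f' g∼g' , v

  StackRel-split : ∀ t {r f f' g g'} → StackTy g r → StackTy g' r →
    StackRel (t ⧺ r) (f ⧺ g) (f' ⧺ g') → StackRel t f f' × StackRel r g g'
  StackRel-split t sε         sε          f∼f'       = f∼f' , tt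
  StackRel-split t (s▸ ⊢g _) (s▸ ⊢g' _) (rel , v) with StackRel-split t ⊢g ⊢g' rel
  ... | f∼f' , g∼g' = f∼f' , g∼g' , v

  MemRel-ε : ∀ {k} → MemRel {k} (replicate k ε) (replicate k ε) (replicate k ε)
  MemRel-ε {zero}  = tt
  MemRel-ε {suc k} = tt , MemRel-ε

  MemRel-⊕ : ∀ {k} (τ ρ : Vec (Stack Ty) k) {F F' G G'} → MemRel τ F F' → MemRel ρ G G' →
    MemRel (τ ⊕ ρ) (F ⊕ G) (F' ⊕ G')
  MemRel-⊕ []      []      {[]}    {[]}    {[]}    {[]}    _            _            = tt
  MemRel-⊕ (t ∷ τ) (r ∷ ρ) {_ ∷ _} {_ ∷ _} {_ ∷ _} {_ ∷ _} (f∼ , F∼) (g∼ , G∼) =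
    StackRel-⧺ t r f∼ g∼ , MemRel-⊕ τ ρ F∼ G∼

  MemRel-split : ∀ {k} (τ ρ : Vec (Stack Ty) k) {F F' G G'} → Typed G ρ → Typed G' ρ →
    MemRel (τ ⊕ ρ) (F ⊕ G) (F' ⊕ G') → MemRel τ F F' × MemRel ρ G G'
  MemRel-split []      []      {[]}    {[]}    {[]}    {[]}    []         []           _          = tt , tt
  MemRel-split (t ∷ τ) (r ∷ ρ) {_ ∷ _} {_ ∷ _} {_ ∷ _} {_ ∷ _} (⊢g ∷ ⊢G) (⊢g' ∷ ⊢G') (x∼ , S∼)
    with StackRel-split t ⊢g ⊢g' x∼ | MemRel-split τ ρ ⊢G ⊢G' S∼
  ... | f∼ , g∼ | F∼ , G∼ = (f∼ , F∼) , (g∼ , G∼)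

  MemRel-push : ∀ {k} a {S S' : Vec (Stack Val) k} {σ V V' r} → MemRel σ S S' → ValRel r V V' →
    MemRel (σ ⊕ single a r) (S [ a ]%= (_▸ V)) (S' [ a ]%= (_▸ V'))
  MemRel-push zero    {_ ∷ S} {_ ∷ S'} {s ∷ σ} (x∼ , S∼) v =
    (x∼ , v) , subst (λ υ → MemRel υ S S') (sym (⊕-identityʳ σ)) S∼
  MemRel-push (suc a) {_ ∷ _} {_ ∷ _}  {_ ∷ _} (x∼ , S∼) v = x∼ , MemRel-push a S∼ v

  MemRel-pop : ∀ {k} a {S S' : Vec (Stack Val) k} {σ r s V s' V'} → MemRel (σ ⊕ single a r) S S' →
    lookup S a ≡ s ▸ V → lookup S' a ≡ s' ▸ V' →
    ValRel r V V' × MemRel σ (S [ a ]≔ s) (S' [ a ]≔ s')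
  MemRel-pop zero    {_ ∷ S} {_ ∷ S'} {_ ∷ σ} ((x∼ , v) , S∼) refl refl =
    v , x∼ , subst (λ υ → MemRel υ S S') (⊕-identityʳ σ) S∼
  MemRel-pop (suc a) {_ ∷ _} {_ ∷ _}  {_ ∷ _} (x∼ , S∼) eq eq' with MemRel-pop a S∼ eq eq'
  ... | v , S∼' = v , x∼ , S∼'

  -- The machine

  ⇓-frame : ∀ F {G M H} → ⟨ G , M ⟩⇓ H → ⟨ F ⊕ G , M ⟩⇓ (F ⊕ H)
  ⇓-frame F halt                            = halt
  ⇓-frame F {G} (mpush {a = a} run)         =
    mpush (subst (λ S → ⟨ S , _ ⟩⇓ _) (sym (updateAt-⊕ F G a λ _ → refl)) (⇓-frame F run))
  ⇓-frame F {G} (mpop {a = a} {s = s} top run) =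
    mpop (trans (lookup-zipWith _⧺_ a F G) (cong (lookup F a ⧺_) top))
         (subst (λ S → ⟨ S , _ ⟩⇓ _) (sym (updateAt-⊕ F G a {g = const s} λ _ → refl))
                (⇓-frame F run))
  ⇓-frame F (mapp run)                      = mapp (⇓-frame F run)

  ⇓-⨾ : ∀ {S N Z M T} → ⟨ S , N ⟩⇓ Z → ⟨ Z , M ⟩⇓ T → ⟨ S , N ⨾ M ⟩⇓ T
  ⇓-⨾ halt                                    runM = runM
  ⇓-⨾ (mpush runN)                            runM = mpush (⇓-⨾ runN runM)
  ⇓-⨾ {M = M} (mpop {V = V} {M = N} top runN) runM =
    mpop top (subst (λ K → ⟨ _ , K ⟩⇓ _) (sym (sub0-⨾ V N M)) (⇓-⨾ runN runM))
  ⇓-⨾ {M = M} (mapp {N = K} {M = N} runN)     runM =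
    mapp (subst (λ K → ⟨ _ , K ⟩⇓ _) (⨾-assoc K N M) (⇓-⨾ runN runM))

  ⨾-⇓ : ∀ {S T} N M → ⟨ S , N ⨾ M ⟩⇓ T → ∃ λ Z → ⟨ S , N ⟩⇓ Z × ⟨ Z , M ⟩⇓ T
  ⨾-⇓ N M run = split N M run refl
    where
    split : ∀ {S P T} N M → ⟨ S , P ⟩⇓ T → P ≡ (N ⨾ M) → ∃ λ Z → ⟨ S , N ⟩⇓ Z × ⟨ Z , M ⟩⇓ T
    split ⋆            M run                   refl = _ , halt , run
    split (push V a N) M (mpush run)           refl with split N M run refl
    ... | Z , runN , runM = Z , mpush runN , runM
    split (pop a N)    M (mpop {V = W} top run) refl with split (sub0 W N) M run (sub0-⨾ W N M)
    ... | Z , runN , runM = Z , mpop top runN , runM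
    split (app V N)    M (mapp {N = K} run)    refl with split (K ⨾ N) M run (sym (⨾-assoc K N M))
    ... | Z , runN , runM = Z , mapp runN , runM

  ⇓-deterministic : ∀ {S M T T'} → ⟨ S , M ⟩⇓ T → ⟨ S , M ⟩⇓ T' → T ≡ T'
  ⇓-deterministic halt           halt             = refl
  ⇓-deterministic (mpush run)    (mpush run')     = ⇓-deterministic run run'
  ⇓-deterministic (mpop top run) (mpop top' run') with ▸-injective (trans (sym top) top')
  ... | refl , refl = ⇓-deterministic run run'
  ⇓-deterministic (mapp run)     (mapp run')      = ⇓-deterministic run run'

  ⋆-⇓ : ∀ {S T} → ⟨ S , ⋆ ⟩⇓ T → T ≡ S
  ⋆-⇓ halt = refl

  ⇓-force : ∀ {S N T} → ⟨ S , N ⟩⇓ T → ⟨ S , ¿ bang N ⟩⇓ T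
  ⇓-force {N = N} run = mapp (subst (λ K → ⟨ _ , K ⟩⇓ _) (sym (⨾-identityʳ N)) run)

  force-⇓ : ∀ {S N T} → ⟨ S , ¿ bang N ⟩⇓ T → ⟨ S , N ⟩⇓ T
  force-⇓ {N = N} (mapp run) = subst (λ K → ⟨ _ , K ⟩⇓ _) (⨾-identityʳ N) run

  app-⇓ : ∀ {F G H V M T} → ⟨ G , ¿ V ⟩⇓ H → ⟨ F ⊕ H , M ⟩⇓ T → ⟨ F ⊕ G , app V M ⟩⇓ T
  app-⇓ {F} (mapp runN) runM = mapp (⇓-⨾ (⇓-frame F (force-⇓ (mapp runN))) runM)

  ⇓-preserves-typing : ∀ {S M σ τ T} → [] ⊢ M ∶ σ ⇒ τ → Typed S σ → ⟨ S , M ⟩⇓ T → Typed T τ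
  ⇓-preserves-typing t⋆                             ⊢S halt           = ⊢S
  ⇓-preserves-typing (tpush {a = a} ⊢V ⊢M)         ⊢S (mpush run)    =
    ⇓-preserves-typing ⊢M (Typed-push a ⊢S ⊢V) run
  ⇓-preserves-typing (tpop {a = a} ⊢M)             ⊢S (mpop top run) with Typed-pop a ⊢S
  ... | _ , _ , top' , ⊢V , ⊢S' with ▸-injective (trans (sym top') top)
  ... | refl , refl = ⇓-preserves-typing (⊢-sub0 ⊢V ⊢M) ⊢S' run
  ⇓-preserves-typing (tapp {τ = τ} (tbang ⊢N) ⊢M)  ⊢S (mapp run)     =
    ⇓-preserves-typing (⊢-⨾ (⊢-frame τ ⊢N) ⊢M) ⊢S run

  ¿-preserves-typing : ∀ {V ρ σ G H} → [] ⊢v V ∶ [ ρ ⇒ σ ] → Typed G ρ → ⟨ G , ¿ V ⟩⇓ H → Typed H σ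
  ¿-preserves-typing (tvar ())
  ¿-preserves-typing (tbang ⊢N) ⊢G run = ⇓-preserves-typing ⊢N ⊢G (force-⇓ run)

  -- The logical relation

  ValRel-sym   : ∀ t {V V'} → ValRel t V V' → ValRel t V' V
  TmRel-sym    : ∀ σ τ {M M'} → TmRel σ τ M M' → TmRel σ τ M' M
  MemRel-sym   : ∀ {k} (σ : Vec (Stack Ty) k) {S S'} → MemRel σ S S' → MemRel σ S' S
  StackRel-sym : ∀ s {x y} → StackRel s x y → StackRel s y x
  ValRel-sym (base b)   (c , eq , refl , refl) = c , eq , refl , refl
  ValRel-sym [ σ ⇒ τ ] M∼M'                    = TmRel-sym σ τ M∼M'
  TmRel-sym σ τ M∼M' S S' ⊢S ⊢S' S∼S' with M∼M' S' S ⊢S' ⊢S (MemRel-sym σ S∼S')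
  ... | T' , T , run' , run , T'∼T = T , T' , run , run' , MemRel-sym τ T'∼T
  MemRel-sym []      {[]}    {[]}    tt         = tt
  MemRel-sym (s ∷ σ) {_ ∷ _} {_ ∷ _} (x∼ , S∼) = StackRel-sym s x∼ , MemRel-sym σ S∼
  StackRel-sym ε       {ε}     {ε}     tt        = tt
  StackRel-sym (s ▸ t) {_ ▸ _} {_ ▸ _} (x∼ , v) = StackRel-sym s x∼ , ValRel-sym t v

  SubstRel : Ctx → Subst → Subst → Set
  SubstRel Γ γ γ' = ∀ {i t} → Γ ∋ i ∶ t →
    [] ⊢v γ i ∶ t × [] ⊢v γ' i ∶ t × ValRel t (γ i) (γ' i)

  OpenTmRel : Ctx → MemTy → MemTy → Tm → Tm → Set
  OpenTmRel Γ σ τ M N = ∀ γ γ' → SubstRel Γ γ γ' → TmRel σ τ (sub γ M) (sub γ' N)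

  OpenValRel : Ctx → Ty → Val → Val → Set
  OpenValRel Γ t V W = ∀ γ γ' → SubstRel Γ γ γ' → ValRel t (subV γ V) (subV γ' W)

  SubstRel-⊢ˡ : ∀ {Γ γ γ'} → SubstRel Γ γ γ' → γ ⊢ˢ Γ ⇒ []
  SubstRel-⊢ˡ γ∼γ' x = proj₁ (γ∼γ' x)

  SubstRel-⊢ʳ : ∀ {Γ γ γ'} → SubstRel Γ γ γ' → γ' ⊢ˢ Γ ⇒ []
  SubstRel-⊢ʳ γ∼γ' x = proj₁ (proj₂ (γ∼γ' x))

  SubstRel-sym : ∀ {Γ γ γ'} → SubstRel Γ γ γ' → SubstRel Γ γ' γ
  SubstRel-sym γ∼γ' x with γ∼γ' x
  ... | ⊢V , ⊢V' , V∼V' = ⊢V' , ⊢V , ValRel-sym _ V∼V'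

  SubstRel-∷ : ∀ {Γ γ γ' r V V'} → SubstRel Γ γ γ' →
    [] ⊢v V ∶ r → [] ⊢v V' ∶ r → ValRel r V V' →
    SubstRel (r ∷ Γ) (V ∷ₛ γ) (V' ∷ₛ γ')
  SubstRel-∷ γ∼γ' ⊢V ⊢V' V∼V' here      = ⊢V , ⊢V' , V∼V'
  SubstRel-∷ γ∼γ' ⊢V ⊢V' V∼V' (there x) = γ∼γ' x

  compat-⋆ : ∀ {Γ τ} → OpenTmRel Γ τ τ ⋆ ⋆
  compat-⋆ γ γ' γ∼γ' S S' ⊢S ⊢S' S∼S' = S , S' , halt , halt , S∼S'

  compat-push : ∀ {Γ V W r a M N σ τ} → Γ ⊢v V ∶ r × Γ ⊢v W ∶ r → OpenValRel Γ r V W →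
    OpenTmRel Γ (σ ⊗ at a r) τ M N → OpenTmRel Γ σ τ (push V a M) (push W a N)
  compat-push {a = a} {σ = σ} (⊢V , ⊢W) V∼W M∼N γ γ' γ∼γ' S S' ⊢S ⊢S' S∼S'
    with M∼N γ γ' γ∼γ' _ _
           (Typed⇒MemOf (Typed-push a (MemOf⇒Typed S σ ⊢S) (⊢v-sub (SubstRel-⊢ˡ γ∼γ') ⊢V)))
           (Typed⇒MemOf (Typed-push a (MemOf⇒Typed S' σ ⊢S') (⊢v-sub (SubstRel-⊢ʳ γ∼γ') ⊢W)))
           (MemRel-push a S∼S' (V∼W γ γ' γ∼γ'))
  ... | T , T' , run , run' , T∼T' = T , T' , mpush run , mpush run' , T∼T'

  compat-pop : ∀ {Γ r a M N σ τ} → OpenTmRel (r ∷ Γ) σ τ M N →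
    OpenTmRel Γ (σ ⊗ at a r) τ (pop a M) (pop a N)
  compat-pop {a = a} {M} {N} {σ} M∼N γ γ' γ∼γ' S S' ⊢S ⊢S' S∼S'
    with Typed-pop a {σ = σ} (MemOf⇒Typed S _ ⊢S) | Typed-pop a {σ = σ} (MemOf⇒Typed S' _ ⊢S')
  ... | _ , V , top , ⊢V , ⊢S₁ | _ , V' , top' , ⊢V' , ⊢S₁' with MemRel-pop a {σ = σ} S∼S' top top'
  ... | V∼V' , S₁∼S₁'
    with M∼N (V ∷ₛ γ) (V' ∷ₛ γ') (SubstRel-∷ γ∼γ' ⊢V ⊢V' V∼V') _ _
             (Typed⇒MemOf ⊢S₁) (Typed⇒MemOf ⊢S₁') S₁∼S₁'
  ... | T , T' , run , run' , T∼T' =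
    T , T' , mpop top  (subst (λ K → ⟨ _ , K ⟩⇓ T)  (sym (sub0-exts V γ M)) run)
           , mpop top' (subst (λ K → ⟨ _ , K ⟩⇓ T') (sym (sub0-exts V' γ' N)) run') , T∼T'

  compat-app : ∀ {Γ V W M N ρ σ τ υ} → Γ ⊢v V ∶ [ ρ ⇒ σ ] × Γ ⊢v W ∶ [ ρ ⇒ σ ] →
    OpenValRel Γ [ ρ ⇒ σ ] V W → OpenTmRel Γ (τ ⊗ σ) υ M N →
    OpenTmRel Γ (τ ⊗ ρ) υ (app V M) (app W N)
  compat-app {ρ = ρ} {σ} {τ} (⊢V , ⊢W) V∼W M∼N γ γ' γ∼γ' S S' ⊢S ⊢S' S∼S'
    with Typed-split {S = S} τ ρ (MemOf⇒Typed S _ ⊢S) | Typed-split {S = S'} τ ρ (MemOf⇒Typed S' _ ⊢S')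
  ... | F , G , refl , ⊢F , ⊢G | F' , G' , refl , ⊢F' , ⊢G' with MemRel-split τ ρ ⊢G ⊢G' S∼S'
  ... | F∼F' , G∼G' with V∼W γ γ' γ∼γ' G G' (Typed⇒MemOf ⊢G) (Typed⇒MemOf ⊢G') G∼G'
  ... | H , H' , runV , runW , H∼H'
    with M∼N γ γ' γ∼γ' (F ⊕ H) (F' ⊕ H')
           (Typed⇒MemOf (Typed-⊕ ⊢F (¿-preserves-typing (⊢v-sub (SubstRel-⊢ˡ γ∼γ') ⊢V) ⊢G runV)))
           (Typed⇒MemOf (Typed-⊕ ⊢F' (¿-preserves-typing (⊢v-sub (SubstRel-⊢ʳ γ∼γ') ⊢W) ⊢G' runW)))
           (MemRel-⊕ τ σ F∼F' H∼H')
  ... | T , T' , run , run' , T∼T' = T , T' , app-⇓ runV run , app-⇓ runW run' , T∼T'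

  compat-var : ∀ {Γ i t} → Γ ∋ i ∶ t → OpenValRel Γ t (var i) (var i)
  compat-var x γ γ' γ∼γ' = proj₂ (proj₂ (γ∼γ' x))

  compat-con : ∀ {Γ c} → OpenValRel Γ (base (constTy c)) (con c) (con c)
  compat-con {c = c} γ γ' γ∼γ' = c , refl , refl , refl

  compat-bang : ∀ {Γ M N σ τ} → OpenTmRel Γ σ τ M N → OpenValRel Γ [ σ ⇒ τ ] (bang M) (bang N)
  compat-bang M∼N γ γ' γ∼γ' S S' ⊢S ⊢S' S∼S' with M∼N γ γ' γ∼γ' S S' ⊢S ⊢S' S∼S'
  ... | T , T' , run , run' , T∼T' = T , T' , ⇓-force run , ⇓-force run' , T∼T'

  fundamental  : ∀ {Γ M σ τ} → Γ ⊢ M ∶ σ ⇒ τ → OpenTmRel Γ σ τ M M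
  fundamentalᵥ : ∀ {Γ V t} → Γ ⊢v V ∶ t → OpenValRel Γ t V V
  fundamental t⋆            = compat-⋆
  fundamental (tpush ⊢V ⊢M) = compat-push (⊢V , ⊢V) (fundamentalᵥ ⊢V) (fundamental ⊢M)
  fundamental (tpop ⊢M)     = compat-pop (fundamental ⊢M)
  fundamental (tapp ⊢V ⊢M)  = compat-app (⊢V , ⊢V) (fundamentalᵥ ⊢V) (fundamental ⊢M)
  fundamentalᵥ (tvar x)   = compat-var x
  fundamentalᵥ tcon       = compat-con
  fundamentalᵥ (tbang ⊢M) = compat-bang (fundamental ⊢M)

  ValRel-refl : ∀ {V t} → [] ⊢v V ∶ t → ValRel t V V
  ValRel-refl {V} {t} ⊢V = subst₂ (ValRel t) (subV-id V) (subV-id V) (fundamentalᵥ ⊢V var var λ ())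

  MemRel-refl : ∀ {k} {S : Vec (Stack Val) k} {σ} → Typed S σ → MemRel σ S S
  MemRel-refl []          = tt
  MemRel-refl (⊢x ∷ ⊢S) = StackRel-refl ⊢x , MemRel-refl ⊢S
    where
    StackRel-refl : ∀ {x s} → StackTy x s → StackRel s x x
    StackRel-refl sε         = tt
    StackRel-refl (s▸ ⊢x ⊢V) = StackRel-refl ⊢x , ValRel-refl ⊢V

  SubstRel-refl : ∀ {Γ γ} → γ ⊢ˢ Γ ⇒ [] → SubstRel Γ γ γ
  SubstRel-refl ⊢γ x = ⊢γ x , ⊢γ x , ValRel-refl (⊢γ x)

  ValRel-trans   : ∀ t {U V W} → ValRel t U V → ValRel t V W → ValRel t U W
  TmRel-trans    : ∀ σ τ {M N P} → TmRel σ τ M N → TmRel σ τ N P → TmRel σ τ M P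
  MemRel-trans   : ∀ {k} (σ : Vec (Stack Ty) k) {S S' S''} →
    MemRel σ S S' → MemRel σ S' S'' → MemRel σ S S''
  StackRel-trans : ∀ s {x y z} → StackRel s x y → StackRel s y z → StackRel s x z
  ValRel-trans (base b)   (c , eq , refl , refl) (_ , _ , refl , refl) = c , eq , refl , refl
  ValRel-trans [ σ ⇒ τ ] M∼N N∼P = TmRel-trans σ τ M∼N N∼P
  -- Use M ∼ N at S ∼ S (reflexivity needs the fundamental lemma): its run of N from S is, by
  -- determinism, the one that N ∼ P relates to the run of P.
  TmRel-trans σ τ M∼N N∼P S S' ⊢S ⊢S' S∼S'
    with M∼N S S ⊢S ⊢S (MemRel-refl (MemOf⇒Typed S _ ⊢S)) | N∼P S S' ⊢S ⊢S' S∼S'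
  ... | T , U , run , runN , T∼U | U' , T' , runN' , run' , U'∼T' rewrite ⇓-deterministic runN' runN =
    T , T' , run , run' , MemRel-trans τ T∼U U'∼T'
  MemRel-trans []      {[]}    {[]}    {[]}    tt        tt          = tt
  MemRel-trans (s ∷ σ) {_ ∷ _} {_ ∷ _} {_ ∷ _} (x∼ , S∼) (y∼ , S'∼) =
    StackRel-trans s x∼ y∼ , MemRel-trans σ S∼ S'∼
  StackRel-trans ε       {ε}     {ε}     {ε}     tt       tt         = tt
  StackRel-trans (s ▸ t) {_ ▸ _} {_ ▸ _} {_ ▸ _} (x∼ , u) (y∼ , v) =
    StackRel-trans s x∼ y∼ , ValRel-trans t u v

  -- Running ⟨x_A⟩ and [x_A]

  popShape-⇓  : ∀ ls {F P θ K T} → ⟨ F , sub (P ++ₛ θ) (popShape ls K) ⟩⇓ T →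
    ∃ λ G → ∃ λ Q → Pops ls F P G Q × ⟨ G , sub (Q ++ₛ θ) K ⟩⇓ T
  popsAt-⇓ : ∀ a n ls {F P θ K T} → ⟨ F , sub (P ++ₛ θ) (popShape ((a , n) ∷ ls) K) ⟩⇓ T →
    ∃ λ G → ∃ λ Q → Pops ((a , n) ∷ ls) F P G Q × ⟨ G , sub (Q ++ₛ θ) K ⟩⇓ T
  popShape-⇓ []             run = _ , _ , done , run
  popShape-⇓ ((a , n) ∷ ls) run = popsAt-⇓ a n ls run
  popsAt-⇓ a zero    ls run with popShape-⇓ ls run
  ... | G , Q , pops , run' = G , Q , next pops , run'
  popsAt-⇓ a (suc n) ls {P = P} {θ} {K} (mpop {V = V} top run)
    with popsAt-⇓ a n ls {P = P ▸ V}
           (subst (λ L → ⟨ _ , L ⟩⇓ _) (sub0-exts V (P ++ₛ θ) (popShape ((a , n) ∷ ls) K)) run)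
  ... | G , Q , pops , run' = G , Q , pop1 top pops , run'

  pushLoc-⇓ : ∀ a tot o n δ {W K T} → ⟨ W , sub δ (pushLoc a tot o n K) ⟩⇓ T →
    ⟨ pushesAt (λ k → δ (tot ∸ suc k)) a o n W , sub δ K ⟩⇓ T
  pushLoc-⇓ a tot o zero    δ run         = run
  pushLoc-⇓ a tot o (suc j) δ (mpush run) = pushLoc-⇓ a tot o j δ run

  pushShape-⇓ : ∀ tot o ls δ {W K T} → ⟨ W , sub δ (pushShape tot o ls K) ⟩⇓ T →
    ⟨ pushes (λ k → δ (tot ∸ suc k)) o ls W , sub δ K ⟩⇓ T
  pushShape-⇓ tot o []             δ run = run
  pushShape-⇓ tot o ((a , n) ∷ ls) δ run = pushShape-⇓ tot (o + n) ls δ (pushLoc-⇓ a tot o n δ run)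

  shape≡shapeOf : ∀ σ → shape σ ≡ shapeOf σ
  shape≡shapeOf σ = trans (shape-tabulate id σ) (map-id (shapeOf σ))

  ⟨⟩∙-⇓ : ∀ σ {F θ K T} → ⟨ F , sub θ (⟨ σ ⟩∙ K) ⟩⇓ T →
    ∃ λ H → ∃ λ G → SameShape H σ × F ≡ G ⊕ H × ⟨ G , sub (popOrder H ++ₛ θ) K ⟩⇓ T
  ⟨⟩∙-⇓ σ {F} {θ} {K} {T} run with popShape-⇓ (shape σ) {P = ε} run
  ... | G , Q , pops , run' with Pops-shapeOf σ (subst (λ ls → Pops ls F ε G Q) (shape≡shapeOf σ) pops)
  ... | H , lH , F≡G⊕H , refl =
    H , G , lH , F≡G⊕H , subst (λ Q → ⟨ G , sub (Q ++ₛ θ) K ⟩⇓ T) (⧺-identityˡ (popOrder H)) run'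

  [_]∙-⇓ : ∀ σ {H} θ → SameShape H σ → ∀ {G K T} → ⟨ G , sub (popOrder H ++ₛ θ) ([ σ ]∙ K) ⟩⇓ T →
    ⟨ G ⊕ H , sub (popOrder H ++ₛ θ) K ⟩⇓ T
  [ σ ]∙-⇓ {H} θ lH {G} {K} {T} run =
    subst (λ F → ⟨ F , _ ⟩⇓ T) pushes≡ (pushShape-⇓ (size σ) 0 (shape σ) _ run)
    where
    Q = popOrder H
    pushes≡ : pushes (λ k → (Q ++ₛ θ) (size σ ∸ suc k)) 0 (shape σ) G ≡ G ⊕ H
    pushes≡ = begin
      pushes (λ k → (Q ++ₛ θ) (size σ ∸ suc k)) 0 (shape σ) G
        ≡⟨ cong (λ n → pushes (λ k → (Q ++ₛ θ) (n ∸ suc k)) 0 (shape σ) G) (sym (slength-popOrder lH)) ⟩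
      pushes (fromBottom Q θ) 0 (shape σ) G
        ≡⟨ cong (λ ls → pushes (fromBottom Q θ) 0 ls G) (shape≡shapeOf σ) ⟩
      pushes (fromBottom Q θ) 0 (shapeOf σ) G
        ≡⟨ pushes-shapeOf (fromBottom Q θ) 0 σ lH
             (TopDownAll-fromBottom Q θ H ε ε (sym (⧺-identityˡ Q))) ⟩
      G ⊕ H ∎
      where open ≡-Reasoning

  sub-wkN : ∀ σ {H} θ → SameShape H σ → ∀ N → sub (popOrder H ++ₛ θ) (wkN (size σ) N) ≡ sub θ N
  sub-wkN σ {H} θ lH N = trans (sub-ren (popOrder H ++ₛ θ) (size σ +_) N) (sub-cong beyond N)
    where
    beyond : ∀ i → (popOrder H ++ₛ θ) (size σ + i) ≡ θ i
    beyond i = trans (cong (λ n → (popOrder H ++ₛ θ) (n + i)) (sym (slength-popOrder lH)))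
                     (++ₛ-beyond (popOrder H) θ i)

  -- Validity of the axioms

  Simulates : MemTy → Tm → Tm → Set
  Simulates τ N N' = ∀ S T → ⟨ S , N ⟩⇓ T →
    ∃ λ T' → ⟨ S , N' ⟩⇓ T' × (∀ U → MemRel τ U T → MemRel τ U T')

  TmRel-simulate : ∀ {σ τ M N N'} → TmRel σ τ M N → Simulates τ N N' → TmRel σ τ M N'
  TmRel-simulate M∼N N≼N' S S' ⊢S ⊢S' S∼S' with M∼N S S' ⊢S ⊢S' S∼S'
  ... | T , T' , run , run' , T∼T' with N≼N' S' T' run'
  ... | T'' , run'' , keep = T , T'' , run , run'' , keep T T∼T'

  same-result : ∀ {τ S N' T T'} → T ≡ T' → ⟨ S , N' ⟩⇓ T' →
    ∃ λ T'' → ⟨ S , N' ⟩⇓ T'' × (∀ U → MemRel τ U T → MemRel τ U T'')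
  same-result refl run = _ , run , λ _ U∼T → U∼T

  MemRel-replaceTop : ∀ {k} (τ : Vec (Stack Ty) k) a {U F V W} → (∀ t U → ValRel t U V → ValRel t U W) →
    MemRel τ U (F [ a ]%= (_▸ V)) → MemRel τ U (F [ a ]%= (_▸ W))
  MemRel-replaceTop ((_ ▸ t) ∷ _) zero    {(_ ▸ U) ∷ _} {_ ∷ _} V≼W ((x∼ , U∼V) , S∼) = (x∼ , V≼W t U U∼V) , S∼
  MemRel-replaceTop (ε ∷ _)       zero    {ε ∷ _}       {_ ∷ _} _   (() , _)
  MemRel-replaceTop (ε ∷ _)       zero    {(_ ▸ _) ∷ _} {_ ∷ _} _   (() , _)
  MemRel-replaceTop (_ ∷ τ)       (suc a) {_ ∷ _}       {_ ∷ _} V≼W (x∼ , S∼) = x∼ , MemRel-replaceTop τ a V≼W S∼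

  -- S terminates from the empty memory because it is related to itself; framing does the rest.
  producer-⇓ : ∀ {Γ S σ γ} → Γ ⊢ S ∶ εA ⇒ σ → γ ⊢ˢ Γ ⇒ [] →
    ∃ λ H → SameShape H σ × (∀ W → ⟨ W , sub γ S ⟩⇓ (W ⊕ H))
  producer-⇓ {S = S} {σ} {γ} ⊢S ⊢γ
    with fundamental ⊢S γ γ (SubstRel-refl ⊢γ) (replicate _ ε) (replicate _ ε)
                     (Typed⇒MemOf Typed-ε) (Typed⇒MemOf Typed-ε) MemRel-ε
  ... | H , _ , run , _ =
    H , Typed⇒SameShape (⇓-preserves-typing (⊢-sub ⊢γ ⊢S) Typed-ε run) ,
    λ W → subst (λ F → ⟨ F , _ ⟩⇓ (W ⊕ H)) (⊕-identityʳ W) (⇓-frame W run)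

  -- By determinism and ⊕-injectiveʳ, ⟨x_A⟩ pops exactly the family that S pushed.
  producer⨾⟨⟩∙-⇓ : ∀ {Γ S σ γ F K T} → Γ ⊢ S ∶ εA ⇒ σ → γ ⊢ˢ Γ ⇒ [] →
    ⟨ F , sub γ (S ⨾ ⟨ σ ⟩∙ K) ⟩⇓ T →
    ∃ λ H → SameShape H σ × (∀ W → ⟨ W , sub γ S ⟩⇓ (W ⊕ H)) × ⟨ F , sub (popOrder H ++ₛ γ) K ⟩⇓ T
  producer⨾⟨⟩∙-⇓ {S = S} {σ} {γ} {F} {K} ⊢S ⊢γ run with producer-⇓ ⊢S ⊢γ
  ... | H₀ , lH₀ , runS
    with ⨾-⇓ (sub γ S) (sub γ (⟨ σ ⟩∙ K)) (subst (λ L → ⟨ F , L ⟩⇓ _) (sub-⨾ γ S _) run)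
  ... | Z , runS' , runK rewrite ⇓-deterministic runS' (runS F) with ⟨⟩∙-⇓ σ runK
  ... | H , G , lH , F⊕H₀≡G⊕H , runK' with ⊕-injectiveʳ σ lH₀ lH F⊕H₀≡G⊕H
  ... | refl , refl = H , lH , runS , runK'

  sub0-push-wkV : ∀ W γ V b K → sub0 W (push (subV (exts γ) (wkV V)) b K) ≡ push (subV γ V) b (sub0 W K)
  sub0-push-wkV W γ V b K =
    trans (sub0-sub W (push (subV (exts γ) (wkV V)) b K)) (cong₂ (λ U L → push U b L) value (sym (sub0-sub W K)))
    where
    value : subV (W ∷ₛ var) (subV (exts γ) (wkV V)) ≡ subV γ V
    value = begin
      subV (W ∷ₛ var) (subV (exts γ) (wkV V))     ≡⟨ subV-sub (W ∷ₛ var) (exts γ) (wkV V) ⟩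
      subV (subV (W ∷ₛ var) ∘ exts γ) (wkV V)     ≡⟨ subV-ren _ suc V ⟩
      subV (subV (W ∷ₛ var) ∘ wkV ∘ γ) V
        ≡⟨ subV-cong (λ i → trans (subV-wkV var W (γ i)) (subV-id (γ i))) V ⟩
      subV γ V                                    ∎
      where open ≡-Reasoning

  runs-after : ∀ γ A B {F T} → ⟨ F , (sub γ A ⨾ sub γ B) ⟩⇓ T → ⟨ F , sub γ (A ⨾ B) ⟩⇓ T
  runs-after γ A B = subst (λ L → ⟨ _ , L ⟩⇓ _) (sym (sub-⨾ γ A B))

  Ax-simulates : ∀ {Γ L R τ} → Ax Γ L R → ∀ γ → γ ⊢ˢ Γ ⇒ [] → Simulates τ (sub γ L) (sub γ R)
  Ax-simulates (ax-η σ) γ ⊢γ F T run with ⟨⟩∙-⇓ σ run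
  ... | H , G , lH , refl , run' = same-result (⋆-⇓ ([ σ ]∙-⇓ γ lH run')) halt
  Ax-simulates (ax-β V a) γ ⊢γ F T (mpush (mpop top run))
    with ▸-injective (trans (sym (lookup∘updateAt a F)) top)
  ... | refl , refl = same-result refl (subst (λ F' → ⟨ F' , _ ⟩⇓ T) (updateAt-restore F a _) run)
  Ax-simulates (ax-?! M) γ ⊢γ F T run = same-result refl (force-⇓ run)
  Ax-simulates {τ = τ} (ax-S! {S} {σ} N a ⊢S) γ ⊢γ F T run
    with producer⨾⟨⟩∙-⇓ {K = push (bang ([ σ ]∙ wkN (size σ) N)) a ⋆} ⊢S ⊢γ run
  ... | H , lH , runS , mpush halt = _ , mpush halt , λ U → MemRel-replaceTop τ a thunk≼
    where
    thunk≼ : ∀ t U → ValRel t U (bang (sub (popOrder H ++ₛ γ) ([ σ ]∙ wkN (size σ) N))) →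
      ValRel t U (bang (sub γ (S ⨾ N)))
    thunk≼ (base _)    U (_ , _ , _ , ())
    thunk≼ [ ρ₁ ⇒ ρ₂ ] U U∼thunk = TmRel-simulate U∼thunk λ G T' run' →
      T' , ⇓-force (runs-after γ S N (⇓-⨾ (runS G)
             (subst (λ L → ⟨ _ , L ⟩⇓ _) (sub-wkN σ γ lH N) ([ σ ]∙-⇓ γ lH (force-⇓ run'))))) , λ _ U∼T' → U∼T'
  Ax-simulates (ax-SS {S} {σ} ⊢S) γ ⊢γ F T run with producer⨾⟨⟩∙-⇓ ⊢S ⊢γ run
  ... | H , lH , runS , run' =
    same-result (⋆-⇓ ([ σ ]∙-⇓ γ lH ([ σ ]∙-⇓ γ lH run')))
                (runs-after γ S S (⇓-⨾ (runS F) (runS (F ⊕ H))))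
  Ax-simulates (ax-S⋆ ⊢S) γ ⊢γ F T run with producer⨾⟨⟩∙-⇓ ⊢S ⊢γ run
  ... | H , lH , runS , run' = same-result (⋆-⇓ run') halt
  Ax-simulates (ax-SP {S} {σ} P ⊢S) γ ⊢γ F T run with producer⨾⟨⟩∙-⇓ ⊢S ⊢γ run
  ... | H , lH , runS , run'
    with ⨾-⇓ _ _ (subst (λ L → ⟨ F , L ⟩⇓ T) (sub-⨾ (popOrder H ++ₛ γ) (wkN (size σ) P) ([ σ ]∙ ⋆)) run')
  ... | G , runP , run'' = same-result (⋆-⇓ ([ σ ]∙-⇓ γ lH run''))
        (runs-after γ P S (⇓-⨾ (subst (λ L → ⟨ F , L ⟩⇓ G) (sub-wkN σ γ lH P) runP) (runS G)))
  Ax-simulates (ax-move V {a} {b} a≢b) γ ⊢γ F T (mpush (mpop top (mpush halt)))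
    with ▸-injective (trans (sym (lookup∘updateAt a F)) top)
  ... | refl , refl = same-result (cong (_[ b ]%= (_▸ subV γ V)) (updateAt-restore F a _)) (mpush halt)
  Ax-simulates (ax-comm V M {a} {b} a≢b) γ ⊢γ F T (mpush (mpop {s = s} {V = W} top run)) =
    same-result refl (mpop (trans (sym (lookup∘updateAt′ a b a≢b F)) top)
      (subst (λ L → ⟨ F [ a ]≔ s , L ⟩⇓ T) (sym (sub0-push-wkV W γ V b _))
        (mpush (subst (λ F' → ⟨ F' , _ ⟩⇓ T) (updateAt-commutes a b a≢b F) run))))

  -- Soundness of the equational theory

  ≐-typed  : ∀ {Γ M N σ τ} → Γ ⊢ M ≐ N ∶ σ ⇒ τ → Γ ⊢ M ∶ σ ⇒ τ × Γ ⊢ N ∶ σ ⇒ τ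
  ≐v-typed : ∀ {Γ V W t} → Γ ⊢v V ≐ W ∶ t → Γ ⊢v V ∶ t × Γ ⊢v W ∶ t
  ≐-typed (ax _ ⊢M ⊢N)      = ⊢M , ⊢N
  ≐-typed (≐refl ⊢M)        = ⊢M , ⊢M
  ≐-typed (≐sym M≐N)        = swap (≐-typed M≐N)
  ≐-typed (≐trans M≐N N≐P)  = proj₁ (≐-typed M≐N) , proj₂ (≐-typed N≐P)
  ≐-typed (≐push V≐W M≐N)   = zip′ tpush tpush (≐v-typed V≐W) (≐-typed M≐N)
  ≐-typed (≐pop M≐N)        = map tpop tpop (≐-typed M≐N)
  ≐-typed (≐app V≐W M≐N)    = zip′ tapp tapp (≐v-typed V≐W) (≐-typed M≐N)
  ≐v-typed (axv _ ⊢V ⊢W)     = ⊢V , ⊢W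
  ≐v-typed (≐vrefl ⊢V)       = ⊢V , ⊢V
  ≐v-typed (≐vsym V≐W)       = swap (≐v-typed V≐W)
  ≐v-typed (≐vtrans U≐V V≐W) = proj₁ (≐v-typed U≐V) , proj₂ (≐v-typed V≐W)
  ≐v-typed (≐bang M≐N)       = map tbang tbang (≐-typed M≐N)

  sound  : ∀ {Γ M N σ τ} → Γ ⊢ M ≐ N ∶ σ ⇒ τ → OpenTmRel Γ σ τ M N
  soundᵥ : ∀ {Γ V W t} → Γ ⊢v V ≐ W ∶ t → OpenValRel Γ t V W
  sound (ax L=R ⊢L _) γ γ' γ∼γ' =
    TmRel-simulate (fundamental ⊢L γ γ' γ∼γ') (Ax-simulates L=R γ' (SubstRel-⊢ʳ γ∼γ'))
  sound (≐refl ⊢M)              = fundamental ⊢M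
  sound {σ = σ} {τ} (≐sym M≐N) γ γ' γ∼γ' = TmRel-sym σ τ (sound M≐N γ' γ (SubstRel-sym γ∼γ'))
  sound {σ = σ} {τ} (≐trans M≐N N≐P) γ γ' γ∼γ' =
    TmRel-trans σ τ (sound M≐N γ γ (SubstRel-refl (SubstRel-⊢ˡ γ∼γ'))) (sound N≐P γ γ' γ∼γ')
  sound (≐push V≐W M≐N)         = compat-push (≐v-typed V≐W) (soundᵥ V≐W) (sound M≐N)
  sound (≐pop M≐N)              = compat-pop (sound M≐N)
  sound (≐app V≐W M≐N)          = compat-app (≐v-typed V≐W) (soundᵥ V≐W) (sound M≐N)
  soundᵥ (axv (ax-!? V) (tbang _) ⊢V) γ γ' γ∼γ' S S' ⊢S ⊢S' S∼S'
    with fundamentalᵥ ⊢V γ γ' γ∼γ' S S' ⊢S ⊢S' S∼S'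
  ... | T , T' , run , run' , T∼T' = T , T' , ⇓-force run , run' , T∼T'
  soundᵥ (≐vrefl ⊢V)            = fundamentalᵥ ⊢V
  soundᵥ {t = t} (≐vsym V≐W) γ γ' γ∼γ' = ValRel-sym t (soundᵥ V≐W γ' γ (SubstRel-sym γ∼γ'))
  soundᵥ {t = t} (≐vtrans U≐V V≐W) γ γ' γ∼γ' =
    ValRel-trans t (soundᵥ U≐V γ γ (SubstRel-refl (SubstRel-⊢ˡ γ∼γ'))) (soundᵥ V≐W γ γ' γ∼γ')
  soundᵥ (≐bang M≐N)            = compat-bang (sound M≐N)

mainTheorem6 : (𝒮 : Setting) → let open FMC 𝒮 in
    ∀ {σ τ M N} →
    [] ⊢ M ∶ σ ⇒ τ → [] ⊢ N ∶ σ ⇒ τ →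
    [] ⊢ M ≐ N ∶ σ ⇒ τ →
    TmRel σ τ M N
mainTheorem6 𝒮 {σ} {τ} {M} {N} _ _ M≐N =
  subst₂ (TmRel σ τ) (sub-id M) (sub-id N) (sound M≐N var var λ ())
  where
  open FMC 𝒮
  open Soundness 𝒮
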